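{- Let $0<k<n$ with $n\equiv 1\pmod k$. Then $\Delta_{n,k}^{stab(r)}$ is $(n-1)$-dimensional for every $r\in\{1,\dots,\lfloor n/k\rfloor\}$. In particular, $\Delta_{n,k}^{stab(\lfloor n/k\rfloor)}$ is a unimodular $(n-1)$-simplex (it has exactly $n$ vertices and is one of the maximal simplices of the circuit triangulation $\nabla_{n,k}$ of $\Delta_{n,k}$).
   Context: For a $k$-subset $I\subseteq[n]$, $\epsilon_I$ denotes its characteristic vector in $\{0,1\}^n$, and $\Delta_{n,k}=\mathrm{conv}\{\epsilon_I:|I|=k\}$. Place $1,\dots,n$ clockwise on a regular $n$-gon; $\mathrm{cd}(i,j)$ is the number of edges of the shortest path between $i$ and $j$. A set $S\subseteq[n]$ is $r$-stable if $\mathrm{cd}(i,j)\ge r$ for all distinct $i,j\in S$; $\Delta_{n,k}^{stab(r)}$ is the convex hull of the $\epsilon_I$ with $I$ an $r$-stable $k$-subset. Unimodular means normalized volume $1$ with respect to the lattice $\mathbb Z^n$ intersected with the affine hull. The circuit triangulation $\nabla_{n,k}$ consists of the simplices $\mathrm{conv}\{\epsilon_{I_1},\dots,\epsilon_{I_d}\}$ where $(I_1,\dots,I_d)$ is sorted, i.e. for all $i<j$, writing the multiset union $I_i\cup I_j$ in nondecreasing order $a_1\le\dots\le a_{2k}$, one has $I_i=\{a_1,a_3,\dots,a_{2k-1}\}$ and $I_j=\{a_2,a_4,\dots,a_{2k}\}$. -}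

module Defs where

open import Data.Nat as ℕ using (ℕ; zero; suc; _≤_; _⊓_; _∸_; ∣_-_∣)
open import Data.Integer as ℤ using (ℤ)
open import Data.Rational as ℚ using (ℚ; 0ℚ; 1ℚ)
open import Data.Fin as Fin using (Fin; toℕ)
open import Data.Fin.Subset using (Subset; _∈_; ∣_∣)
open import Data.Fin.Subset.Properties using (_∈?_)
open import Data.Vec using (lookup)
open import Data.Bool using (if_then_else_)
open import Data.List using (List; []; _∷_; filter)
open import Data.Fin.Base using () renaming (_<_ to _<ᶠ_)
open import Data.Fin.Properties using (_≤?_)
open import Data.List.Base using () renaming (allFin to allFinL)
open import Data.Product using (Σ; ∃; _×_; _,_)
open import Relation.Binary.PropositionalEquality using (_≡_; _≢_)
open import Relation.Nullary using (yes; no)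
open import Function using (_∘_)

-- Ground set [n] is modelled by Fin n (label i+1 ↔ Fin element i).
-- Subsets of [n] are Data.Fin.Subset.Subset n.

Σℚ : ∀ {m} → (Fin m → ℚ) → ℚ
Σℚ {zero}  f = 0ℚ
Σℚ {suc m} f = f Fin.zero ℚ.+ Σℚ (f ∘ Fin.suc)

Σℤ : ∀ {m} → (Fin m → ℤ) → ℤ
Σℤ {zero}  f = ℤ.+ 0
Σℤ {suc m} f = f Fin.zero ℤ.+ Σℤ (f ∘ Fin.suc)

χ : ∀ {n} → Subset n → Fin n → ℚ
χ I c = if lookup I c then 1ℚ else 0ℚ

χℤ : ∀ {n} → Subset n → Fin n → ℤ
χℤ I c = if lookup I c then ℤ.+ 1 else ℤ.+ 0

IsKSubset : ∀ {n} → ℕ → Subset n → Set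
IsKSubset k I = ∣ I ∣ ≡ k

cd : ∀ {n} → Fin n → Fin n → ℕ
cd {n} i j = ∣ toℕ i - toℕ j ∣ ⊓ (n ∸ ∣ toℕ i - toℕ j ∣)

IsStable : ∀ {n} → ℕ → Subset n → Set
IsStable r S = ∀ i j → i ∈ S → j ∈ S → i ≢ j → r ≤ cd i j

-- r-stable k-subsets: the vertex set defining Δ_{n,k}^{stab(r)}
StableKSubset : ∀ {n} → ℕ → ℕ → Subset n → Set
StableKSubset k r I = IsKSubset k I × IsStable r I

AffIndep : ∀ {m n} → (Fin m → Fin n → ℚ) → Set
AffIndep {m} v = (λ' : Fin m → ℚ) → Σℚ λ' ≡ 0ℚ →
  (∀ c → Σℚ (λ a → λ' a ℚ.* v a c) ≡ 0ℚ) → ∀ a → λ' a ≡ 0ℚ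

-- The polytope conv{ ε_I : P I } has dimension d: its affine hull
-- (= affine hull of the ε_I with P I) has dimension d, i.e. the maximal
-- number of affinely independent points among the ε_I is d+1.
ConvDim : ∀ {n} → (Subset n → Set) → ℕ → Set
ConvDim {n} P d =
  (Σ (Fin (suc d) → Subset n) λ f → (∀ a → P (f a)) × AffIndep (χ ∘ f))
  × (∀ m (f : Fin m → Subset n) → (∀ a → P (f a)) → AffIndep (χ ∘ f) → m ≤ suc d)

-- A lattice simplex with vertices ε_{f a} is unimodular (normalized volume 1
-- w.r.t. ℤⁿ ∩ affine hull) iff it is a simplex (affinely independent vertices)
-- and every lattice point of the affine hull is an integral affine
-- combination of the vertices (the vertices form an affine lattice basis).
Unimodular : ∀ {m n} → (Fin m → Subset n) → Set
Unimodular {m} {n} f =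
  AffIndep (χ ∘ f) ×
  ((z : Fin n → ℤ) (μ : Fin m → ℚ) → Σℚ μ ≡ 1ℚ →
     (∀ c → Σℚ (λ a → μ a ℚ.* χ (f a) c) ≡ (z c ℚ./ 1)) →
     Σ (Fin m → ℤ) λ ν → Σℤ ν ≡ ℤ.+ 1 ×
       (∀ c → Σℤ (λ a → ν a ℤ.* χℤ (f a) c) ≡ z c))

elems : ∀ {n} → Subset n → List ℕ
elems {n} I = Data.List.map toℕ (filter (_∈? I) (allFinL n))
  where import Data.List

merge : List ℕ → List ℕ → List ℕ
merge [] ys = ys
merge (x ∷ xs) [] = x ∷ xs
merge (x ∷ xs) (y ∷ ys) =
  if x ℕ.≤ᵇ y then x ∷ merge xs (y ∷ ys) else y ∷ merge (x ∷ xs) ys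

odds evens : List ℕ → List ℕ
odds [] = []
odds (x ∷ xs) = x ∷ evens xs
evens [] = []
evens (x ∷ xs) = odds xs

-- (I, J) is sorted: writing I ∪ J (multiset) as a₁ ≤ … ≤ a_{2k},
-- I = {a₁,a₃,…} and J = {a₂,a₄,…}
SortedPair : ∀ {n} → Subset n → Subset n → Set
SortedPair I J = odds (merge (elems I) (elems J)) ≡ elems I
               × evens (merge (elems I) (elems J)) ≡ elems J

SortedTuple : ∀ {m n} → ℕ → (Fin m → Subset n) → Set
SortedTuple k f = (∀ a → IsKSubset k (f a)) × (∀ a b → a <ᶠ b → SortedPair (f a) (f b))

-- a vertex set T (a set of k-subsets) spans a simplex of ∇_{n,k}:
-- T = {I₁,…,I_m} for a sorted tuple
IsCircuitSimplex : ∀ {n} → ℕ → (Subset n → Set) → Set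
IsCircuitSimplex {n} k T = ∃ λ m → Σ (Fin m → Subset n) λ f →
  SortedTuple k f × (∀ a → T (f a)) × (∀ I → T I → ∃ λ a → f a ≡ I)

IsMaxCircuitSimplex : ∀ {n} → ℕ → (Subset n → Set) → Set₁
IsMaxCircuitSimplex {n} k T = IsCircuitSimplex k T ×
  ((T' : Subset n → Set) → IsCircuitSimplex k T' → (∀ I → T I → T' I) → ∀ I → T' I → T I)

{-# OPTIONS --safe #-}
module Submission where

open import Defs
open import Algebra.Bundles using (CommutativeRing)
open import Data.Bool using (Bool; true; false; if_then_else_)
open import Data.Empty using (⊥; ⊥-elim)
open import Data.Fin as Fin using (Fin; zero; suc; toℕ; fromℕ<; punchIn)
import Data.Fin.Properties as Finₚ
open import Data.Fin.Subset using (Subset; _∈_; ∣_∣)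
open import Data.Fin.Subset.Properties using (_∈?_)
open import Data.Integer as ℤ using (ℤ)
import Data.Integer.Properties as ℤₚ
open import Data.List as List using (List; []; _∷_; map; filter; upTo)
import Data.List.Extrema
open import Data.List.Membership.Propositional.Properties using (∈-upTo⁺; ∈-upTo⁻)
import Data.List.Properties as Listₚ
import Data.List.Relation.Unary.All as All
open import Data.Nat
  using ( ℕ; zero; suc; _+_; _*_; _∸_; _/_; _%_; _⊓_; _≤_; _<_; _≤′_; ≤′-refl; ≤′-step; z≤n; s≤s; s≤s⁻¹; z<s
        ; _<ᵇ_; _<?_; _≤?_; NonZero; ≢-nonZero⁻¹)
open import Data.Nat.Coprimality using (Coprime; coprime-divisor)
open import Data.Nat.DivMod
  using (m/n*n≤m; m<n*o⇒m/o<n; /-monoˡ-≤; m*n/n≡m; m<n⇒m/n≡0; m≡m%n+[m/n]*n; m%n<n; +-distrib-/-∣ʳ)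
open import Data.Nat.Divisibility using (_∣_; divides; ∣m+n∣m⇒∣n; n∣m*n; m∣m*n; ∣1⇒≡1; ∣-trans)
open import Data.Nat.Properties
open import Algebra.Properties.CommutativeSemigroup +-commutativeSemigroup
  using (x∙yz≈y∙xz; xy∙z≈y∙xz; xy∙z≈zx∙y; xy∙z≈xz∙y)
open import Data.Nat.Tactic.RingSolver using (solve-∀)
open import Data.Product using (Σ; ∃; _×_; _,_; proj₁; proj₂; map₂)
open import Data.Product.Function.NonDependent.Propositional using (_×-⇔_)
open import Data.Rational as ℚ using (ℚ; 0ℚ; 1ℚ)
open import Data.Rational.Literals using (fromℤ)
import Data.Rational.Properties as ℚₚ
open import Data.Rational.Solver using (module +-*-Solver)
open import Data.Rational.Unnormalised using (*≡*)
import Data.Rational.Unnormalised.Properties as ℚᵘₚ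
open import Algebra.Properties.Semiring.Sum (CommutativeRing.semiring ℚₚ.+-*-commutativeRing)
  using (sum; sum-cong-≗; ∑-distrib-+; ∑-comm; *-distribˡ-sum; *-distribʳ-sum; sum-replicate-zero; sum-remove)
open import Data.Sum using (_⊎_; inj₁; inj₂)
open import Data.Unit using (⊤; tt)
open import Data.Vec using (Vec; []; _∷_; _++_; lookup; tabulate)
open import Data.Vec.Functional using (insertAt)
open import Data.Vec.Functional.Properties using (insertAt-lookup; insertAt-punchIn)
import Data.Vec.Properties as Vecₚ
open import Function using (_∘_; id; _⇔_; mk⇔; Equivalence)
open import Function.Definitions using (Injective)
open import Function.Properties.Equivalence using () renaming (refl to ⇔-refl; trans to ⇔-trans)
open import Relation.Binary using (tri<; tri≈; tri>)
open import Relation.Binary.PropositionalEquality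
  using (_≡_; _≢_; refl; sym; trans; cong; cong₂; subst; subst₂; module ≡-Reasoning)
open import Relation.Nullary using (¬_; yes; no)
open import Relation.Nullary.Decidable using (¬?; decidable-stable)

-- Write n = q k + 1. For u < n let W u = mechanical u be the set of positions at which
-- c ↦ ⌊(c k + u) / n⌋ increases (a mechanical word of slope k / n), so that this floor
-- function is the counting function of W u. Two members of W u are at least q apart,
-- also around the n-gon, so W u is q-stable. Conversely, the cyclic gaps of a q-stable
-- k-subset I are all ≥ q, which keeps n P(c) − c k within an interval of length
-- q k = n − 1, P being the counting function of I; then P(c) = ⌊(c k + u) / n⌋ for u the
-- maximum of n P(c) − c k, i.e. I = W u. Counting functions of the W u pairwise differ by at
-- most one, which is exactly sortedness, so the W u span a simplex of the circuit
-- triangulation; it is maximal because a k-subset sorted against every W u satisfies the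
-- same interval bound. Since c ↦ c k mod n is a bijection, the coordinates of a combination
-- of the W u determine the prefix sums of its coefficients: this gives affine independence,
-- hence dimension n − 1 (any affinely independent family of k-subsets has at most n
-- members), and unimodularity (integral coordinates force integral coefficients).

-- Functions with unit steps

UnitSteps : (ℕ → ℕ) → Set
UnitSteps P = ∀ c → P c ≤ P (suc c) × P (suc c) ≤ suc (P c)

Jump : (ℕ → ℕ) → ℕ → Set
Jump P x = P (suc x) ≡ suc (P x)

module _ {P : ℕ → ℕ} (steps : UnitSteps P) where

  unitSteps⇒mono : ∀ {c c′} → c ≤ c′ → P c ≤ P c′
  unitSteps⇒mono = mono′ ∘ ≤⇒≤′
    where
    mono′ : ∀ {c c′} → c ≤′ c′ → P c ≤ P c′
    mono′ ≤′-refl = ≤-refl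
    mono′ (≤′-step h) = ≤-trans (mono′ h) (proj₁ (steps _))

  first-jump : ∀ a b → P a < P b → ∃ λ x → a ≤ x × x < b × P x ≡ P a × Jump P x
  first-jump a zero Pa<P0 = ⊥-elim (<⇒≱ Pa<P0 (unitSteps⇒mono z≤n))
  first-jump a (suc b) Pa<Pb+1 with P a <? P b
  ... | yes Pa<Pb =
    let x , a≤x , x<b , Px≡Pa , jump = first-jump a b Pa<Pb in
    x , a≤x , m<n⇒m<1+n x<b , Px≡Pa , jump
  ... | no Pa≮Pb = b , a≤b , n<1+n b , sym Pa≡Pb , jump
    where
    Pa≡Pb : P a ≡ P b
    Pa≡Pb = ≤-antisym (s≤s⁻¹ (≤-trans Pa<Pb+1 (proj₂ (steps b)))) (≮⇒≥ Pa≮Pb)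
    jump : Jump P b
    jump = ≤-antisym (proj₂ (steps b)) (subst (λ z → suc z ≤ P (suc b)) Pa≡Pb Pa<Pb+1)
    a≤b : a ≤ b
    a≤b = ≮⇒≥ λ b<a → <⇒≱ Pa<Pb+1 (unitSteps⇒mono b<a)

two-jumps : ∀ {P} → UnitSteps P → ∀ {x y} → x < y → Jump P x → Jump P y → suc (suc (P x)) ≤ P (suc y)
two-jumps steps {x} {y} x<y jump-x jump-y =
  subst₂ _≤_ (cong suc jump-x) (sym jump-y) (s≤s (unitSteps⇒mono steps x<y))

Gapped : ℕ → (ℕ → ℕ) → Set
Gapped g P = ∀ {x y} → x < y → Jump P x → Jump P y → x + g ≤ y

module _ {g : ℕ} {P : ℕ → ℕ} (steps : UnitSteps P) (gapped : Gapped g P) where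

  window-step : ∀ c → P (c + g) ≤ suc (P c)
  window-step c = ≮⇒≥ λ 1+Pc<P[c+g] →
    let x , c≤x , _ , Px≡Pc , jump-x = first-jump steps c (c + g) (<-trans (n<1+n (P c)) 1+Pc<P[c+g])
        P[1+x]<P[c+g] = subst (_< P (c + g)) (sym (trans jump-x (cong suc Px≡Pc))) 1+Pc<P[c+g]
        y , x<y , y<c+g , _ , jump-y = first-jump steps (suc x) (c + g) P[1+x]<P[c+g]
    in <⇒≱ y<c+g (≤-trans (+-monoˡ-≤ g c≤x) (gapped x<y jump-x jump-y))

  window : ∀ j c → P (c + j * g) ≤ P c + j
  window zero c = ≤-reflexive (trans (cong P (+-identityʳ c)) (sym (+-identityʳ (P c))))
  window (suc j) c = begin
    P (c + suc j * g)  ≡⟨ cong P (sym (+-assoc c g (j * g))) ⟩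
    P (c + g + j * g)  ≤⟨ window j (c + g) ⟩
    P (c + g) + j      ≤⟨ +-monoˡ-≤ j (window-step c) ⟩
    suc (P c) + j      ≡⟨ +-suc (P c) j ⟨
    P c + suc j        ∎
    where open ≤-Reasoning

  window-length : ∀ {c L} j → P c + suc j ≤ P (c + L) → j * g < L
  window-length {c} {L} j many = ≰⇒> λ L≤jg →
    <⇒≱ (subst (_≤ P (c + L)) (+-suc (P c) j) many)
        (≤-trans (unitSteps⇒mono steps (+-monoʳ-≤ c L≤jg)) (window j c))

-- Counting functions of subsets

bit : Bool → ℕ
bit true = 1
bit false = 0

count : ∀ {m} → Vec Bool m → ℕ → ℕ
count v zero = 0
count [] (suc c) = 0
count (b ∷ v) (suc c) = bit b + count v c

count-unitSteps : ∀ {m} (v : Vec Bool m) → UnitSteps (count v)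
count-unitSteps [] zero = z≤n , z≤n
count-unitSteps [] (suc c) = z≤n , z≤n
count-unitSteps (true ∷ v) zero = z≤n , s≤s z≤n
count-unitSteps (false ∷ v) zero = z≤n , z≤n
count-unitSteps (b ∷ v) (suc c) =
  let lo , hi = count-unitSteps v c in
  +-monoʳ-≤ (bit b) lo , ≤-trans (+-monoʳ-≤ (bit b) hi) (≤-reflexive (+-suc (bit b) (count v c)))

count-saturates : ∀ {m} (v : Vec Bool m) {c} → m ≤ c → count v c ≡ count v m
count-saturates [] {zero} _ = refl
count-saturates [] {suc c} _ = refl
count-saturates (b ∷ v) {suc c} (s≤s m≤c) = cong (bit b +_) (count-saturates v m≤c)

∣v∣≡count : ∀ {m} (v : Vec Bool m) → ∣ v ∣ ≡ count v m
∣v∣≡count [] = refl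
∣v∣≡count (true ∷ v) = cong suc (∣v∣≡count v)
∣v∣≡count (false ∷ v) = ∣v∣≡count v

count-suc-toℕ : ∀ {m} (v : Vec Bool m) i → count v (suc (toℕ i)) ≡ bit (lookup v i) + count v (toℕ i)
count-suc-toℕ (b ∷ v) Fin.zero = refl
count-suc-toℕ (b ∷ v) (Fin.suc i) =
  trans (cong (bit b +_) (count-suc-toℕ v i)) (x∙yz≈y∙xz (bit b) (bit (lookup v i)) (count v (toℕ i)))

∈⇒jump : ∀ {m} (v : Vec Bool m) {i} → i ∈ v → Jump (count v) (toℕ i)
∈⇒jump v {i} i∈v = trans (count-suc-toℕ v i) (cong (λ b → bit b + count v (toℕ i)) (Vecₚ.[]=⇒lookup i∈v))

jump⇒< : ∀ {m} (v : Vec Bool m) {x} → Jump (count v) x → x < m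
jump⇒< v {x} jump = ≰⇒> λ m≤x →
  1+n≢n (trans (sym jump) (trans (count-saturates v (m≤n⇒m≤1+n m≤x)) (sym (count-saturates v m≤x))))

jump⇒∈ : ∀ {m} (v : Vec Bool m) {x} (x<m : x < m) → Jump (count v) x → fromℕ< x<m ∈ v
jump⇒∈ v {x} x<m jump = Vecₚ.lookup⇒[]= i v (bit≡1 (lookup v i) (trans (sym step) jump))
  where
  i = fromℕ< x<m
  step : count v (suc x) ≡ bit (lookup v i) + count v x
  step = subst (λ z → count v (suc z) ≡ bit (lookup v i) + count v z) (Finₚ.toℕ-fromℕ< x<m) (count-suc-toℕ v i)
  bit≡1 : ∀ b → bit b + count v x ≡ suc (count v x) → b ≡ true
  bit≡1 true _ = refl
  bit≡1 false eq = ⊥-elim (1+n≢n (sym eq))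

bit-injective : ∀ {a b} → bit a ≡ bit b → a ≡ b
bit-injective {true} {true} _ = refl
bit-injective {false} {false} _ = refl

bit-< : ∀ {m n} → m < n → bit (m <ᵇ n) ≡ 1
bit-< {zero} {suc n} _ = refl
bit-< {suc m} {suc n} (s≤s m<n) = bit-< m<n

bit-≥ : ∀ {m n} → n ≤ m → bit (m <ᵇ n) ≡ 0
bit-≥ z≤n = refl
bit-≥ (s≤s n≤m) = bit-≥ n≤m

count-injective : ∀ {m} (v w : Vec Bool m) → (∀ c → c ≤ m → count v c ≡ count w c) → v ≡ w
count-injective [] [] _ = refl
count-injective (a ∷ v) (b ∷ w) same with bit-injective {a} {b} (+-cancelʳ-≡ 0 _ _ (same 1 (s≤s z≤n)))
... | refl = cong (a ∷_) (count-injective v w λ c c≤m → +-cancelˡ-≡ (bit a) _ _ (same (suc c) (s≤s c≤m)))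

count-++ˡ : ∀ {m p} (u : Vec Bool m) (v : Vec Bool p) {c} → c ≤ m → count (u ++ v) c ≡ count u c
count-++ˡ u v {zero} _ = refl
count-++ˡ (b ∷ u) v {suc c} (s≤s c≤m) = cong (bit b +_) (count-++ˡ u v c≤m)

count-++ʳ : ∀ {m p} (u : Vec Bool m) (v : Vec Bool p) c → count (u ++ v) (m + c) ≡ count u m + count v c
count-++ʳ [] v c = refl
count-++ʳ (b ∷ u) v c = trans (cong (bit b +_) (count-++ʳ u v c)) (sym (+-assoc (bit b) _ _))

jumpsOf : (m : ℕ) → (ℕ → ℕ) → Vec Bool m
jumpsOf m H = tabulate λ i → H (toℕ i) <ᵇ H (suc (toℕ i))

count-jumpsOf : ∀ m {H} → UnitSteps H → ∀ {c} → c ≤ m → count (jumpsOf m H) c + H 0 ≡ H c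
count-jumpsOf m {H} steps {zero} _ = refl
count-jumpsOf (suc m) {H} steps {suc c} (s≤s c≤m) = begin
  bit (H 0 <ᵇ H 1) + count (jumpsOf m (H ∘ suc)) c + H 0
    ≡⟨ xy∙z≈y∙xz (bit (H 0 <ᵇ H 1)) _ (H 0) ⟩
  count (jumpsOf m (H ∘ suc)) c + (bit (H 0 <ᵇ H 1) + H 0)
    ≡⟨ cong (count (jumpsOf m (H ∘ suc)) c +_) (unit-step (H 0) (H 1) (steps 0)) ⟩
  count (jumpsOf m (H ∘ suc)) c + H 1
    ≡⟨ count-jumpsOf m (steps ∘ suc) c≤m ⟩
  H (suc c) ∎
  where
  open ≡-Reasoning
  unit-step : ∀ a b → a ≤ b × b ≤ suc a → bit (a <ᵇ b) + a ≡ b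
  unit-step zero zero _ = refl
  unit-step zero (suc zero) _ = refl
  unit-step zero (suc (suc b)) (_ , s≤s ())
  unit-step (suc a) (suc b) (s≤s a≤b , s≤s b≤1+a) =
    trans (+-suc (bit (a <ᵇ b)) a) (cong suc (unit-step a b (a≤b , b≤1+a)))

-- Sorted pairs

Leads : ∀ {m} → ℕ → Vec Bool m → Vec Bool m → Set
Leads d I J = ∀ c → count J c ≤ d + count I c × d + count I c ≤ suc (count J c)

leads-refl : ∀ {m} (I : Vec Bool m) → Leads 0 I I
leads-refl I c = ≤-refl , n≤1+n (count I c)

leads-upTo : ∀ {m d} (I J : Vec Bool m) →
  (∀ c → c ≤ m → count J c ≤ d + count I c × d + count I c ≤ suc (count J c)) → Leads d I J
leads-upTo {m} {d} I J h c with ≤-total c m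
... | inj₁ c≤m = h c c≤m
... | inj₂ m≤c rewrite count-saturates I m≤c | count-saturates J m≤c = h m ≤-refl

-- Alt₀ I J: scanning positions from left to right, the members of I and J alternate,
-- starting with I; in Alt₁ I J one member of I is still waiting for its partner in J.
Alt₀ Alt₁ : ∀ {m} → Vec Bool m → Vec Bool m → Set
Alt₀ [] [] = ⊤
Alt₀ (true ∷ I) (true ∷ J) = Alt₀ I J
Alt₀ (true ∷ I) (false ∷ J) = Alt₁ I J
Alt₀ (false ∷ I) (true ∷ J) = ⊥
Alt₀ (false ∷ I) (false ∷ J) = Alt₀ I J
Alt₁ [] [] = ⊤
Alt₁ (true ∷ I) (true ∷ J) = Alt₁ I J
Alt₁ (true ∷ I) (false ∷ J) = ⊥
Alt₁ (false ∷ I) (true ∷ J) = Alt₀ I J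
Alt₁ (false ∷ I) (false ∷ J) = Alt₁ I J

alt₀⇒leads : ∀ {m} (I J : Vec Bool m) → Alt₀ I J → Leads 0 I J
alt₁⇒leads : ∀ {m} (I J : Vec Bool m) → Alt₁ I J → Leads 1 I J
alt₀⇒leads I J alt zero = z≤n , z≤n
alt₀⇒leads [] [] alt (suc c) = z≤n , z≤n
alt₀⇒leads (true ∷ I) (true ∷ J) alt (suc c) = let lo , hi = alt₀⇒leads I J alt c in s≤s lo , s≤s hi
alt₀⇒leads (true ∷ I) (false ∷ J) alt (suc c) = alt₁⇒leads I J alt c
alt₀⇒leads (false ∷ I) (false ∷ J) alt (suc c) = alt₀⇒leads I J alt c
alt₁⇒leads I J alt zero = z≤n , s≤s z≤n
alt₁⇒leads [] [] alt (suc c) = z≤n , s≤s z≤n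
alt₁⇒leads (true ∷ I) (true ∷ J) alt (suc c) = let lo , hi = alt₁⇒leads I J alt c in s≤s lo , s≤s hi
alt₁⇒leads (false ∷ I) (true ∷ J) alt (suc c) = let lo , hi = alt₀⇒leads I J alt c in s≤s lo , s≤s hi
alt₁⇒leads (false ∷ I) (false ∷ J) alt (suc c) = alt₁⇒leads I J alt c

leads⇒alt₀ : ∀ {m} (I J : Vec Bool m) → Leads 0 I J → Alt₀ I J
leads⇒alt₁ : ∀ {m} (I J : Vec Bool m) → Leads 1 I J → Alt₁ I J
leads⇒alt₀ [] [] _ = tt
leads⇒alt₀ (true ∷ I) (true ∷ J) leads = leads⇒alt₀ I J λ c → let lo , hi = leads (suc c) in s≤s⁻¹ lo , s≤s⁻¹ hi
leads⇒alt₀ (true ∷ I) (false ∷ J) leads = leads⇒alt₁ I J (leads ∘ suc)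
leads⇒alt₀ (false ∷ I) (true ∷ J) leads with leads 1
... | () , _
leads⇒alt₀ (false ∷ I) (false ∷ J) leads = leads⇒alt₀ I J (leads ∘ suc)
leads⇒alt₁ [] [] _ = tt
leads⇒alt₁ (true ∷ I) (true ∷ J) leads = leads⇒alt₁ I J λ c → let lo , hi = leads (suc c) in s≤s⁻¹ lo , s≤s⁻¹ hi
leads⇒alt₁ (true ∷ I) (false ∷ J) leads with leads 1
... | _ , s≤s ()
leads⇒alt₁ (false ∷ I) (true ∷ J) leads = leads⇒alt₀ I J λ c → let lo , hi = leads (suc c) in s≤s⁻¹ lo , s≤s⁻¹ hi
leads⇒alt₁ (false ∷ I) (false ∷ J) leads = leads⇒alt₁ I J (leads ∘ suc)

⇑ : List ℕ → List ℕ
⇑ = map suc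

private
  ⇑-injective : Injective _≡_ _≡_ ⇑
  ⇑-injective = Listₚ.map-injective suc-injective

  0∷⇑-injective : Injective _≡_ _≡_ ((0 ∷_) ∘ ⇑)
  0∷⇑-injective = ⇑-injective ∘ Listₚ.∷-injectiveʳ

  0∷≢⇑ : ∀ {l} ys → 0 ∷ l ≢ ⇑ ys
  0∷≢⇑ [] ()
  0∷≢⇑ (y ∷ ys) ()

merge-[]ʳ : ∀ xs → merge xs [] ≡ xs
merge-[]ʳ [] = refl
merge-[]ʳ (x ∷ xs) = refl

merge-⇑ : ∀ xs ys → merge (⇑ xs) (⇑ ys) ≡ ⇑ (merge xs ys)
merge-⇑ [] ys = refl
merge-⇑ (x ∷ xs) [] = refl
merge-⇑ (zero ∷ xs) (y ∷ ys) = cong (1 ∷_) (merge-⇑ xs (y ∷ ys))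
merge-⇑ (suc x ∷ xs) (y ∷ ys) = ⇑-if (x <ᵇ y) (merge-⇑ xs (y ∷ ys)) (merge-⇑ (suc x ∷ xs) ys)
  where
  ⇑-if : ∀ b {x y l l′ r r′} → l ≡ ⇑ l′ → r ≡ ⇑ r′ →
    (if b then suc x ∷ l else suc y ∷ r) ≡ ⇑ (if b then x ∷ l′ else y ∷ r′)
  ⇑-if true l≡ _ = cong (suc _ ∷_) l≡
  ⇑-if false _ r≡ = cong (suc _ ∷_) r≡

merge-⇑-0∷⇑ : ∀ xs ys → merge (⇑ xs) (0 ∷ ⇑ ys) ≡ 0 ∷ ⇑ (merge xs ys)
merge-⇑-0∷⇑ [] ys = refl
merge-⇑-0∷⇑ (x ∷ xs) ys = cong (0 ∷_) (merge-⇑ (x ∷ xs) ys)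

merge-0∷⇑-⇑ : ∀ xs ys → merge (0 ∷ ⇑ xs) (⇑ ys) ≡ 0 ∷ ⇑ (merge xs ys)
merge-0∷⇑-⇑ xs [] = cong ((0 ∷_) ∘ ⇑) (sym (merge-[]ʳ xs))
merge-0∷⇑-⇑ xs (y ∷ ys) = cong (0 ∷_) (merge-⇑ xs (y ∷ ys))

merge-0∷⇑-0∷⇑ : ∀ xs ys → merge (0 ∷ ⇑ xs) (0 ∷ ⇑ ys) ≡ 0 ∷ 0 ∷ ⇑ (merge xs ys)
merge-0∷⇑-0∷⇑ xs ys = cong (0 ∷_) (merge-⇑-0∷⇑ xs ys)

odds-⇑ : ∀ l → odds (⇑ l) ≡ ⇑ (odds l)
evens-⇑ : ∀ l → evens (⇑ l) ≡ ⇑ (evens l)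
odds-⇑ [] = refl
odds-⇑ (x ∷ l) = cong (suc x ∷_) (evens-⇑ l)
evens-⇑ [] = refl
evens-⇑ (x ∷ l) = odds-⇑ l

Alternate Alternate′ : List ℕ → List ℕ → Set
Alternate xs ys = odds (merge xs ys) ≡ xs × evens (merge xs ys) ≡ ys
Alternate′ xs ys = evens (merge xs ys) ≡ xs × odds (merge xs ys) ≡ ys

private
  cancel⇔ : ∀ {f : List ℕ → List ℕ} → Injective _≡_ _≡_ f →
    ∀ {l l′ xs} → l ≡ f l′ → (l ≡ f xs ⇔ l′ ≡ xs)
  cancel⇔ f-inj l≡fl′ =
    mk⇔ (λ l≡fxs → f-inj (trans (sym l≡fl′) l≡fxs)) (λ l′≡xs → trans l≡fl′ (cong _ l′≡xs))

module _ (xs ys : List ℕ) where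
  private
    m = merge xs ys
    tt-merge = merge-0∷⇑-0∷⇑ xs ys
    tf-merge = merge-0∷⇑-⇑ xs ys
    ft-merge = merge-⇑-0∷⇑ xs ys
    ff-merge = merge-⇑ xs ys

  alternate-tt : Alternate (0 ∷ ⇑ xs) (0 ∷ ⇑ ys) ⇔ Alternate xs ys
  alternate-tt =
    cancel⇔ 0∷⇑-injective (trans (cong odds tt-merge) (cong (0 ∷_) (odds-⇑ m))) ×-⇔
    cancel⇔ 0∷⇑-injective (trans (cong evens tt-merge) (cong (0 ∷_) (evens-⇑ m)))

  alternate-tf : Alternate (0 ∷ ⇑ xs) (⇑ ys) ⇔ Alternate′ xs ys
  alternate-tf =
    cancel⇔ 0∷⇑-injective (trans (cong odds tf-merge) (cong (0 ∷_) (evens-⇑ m))) ×-⇔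
    cancel⇔ ⇑-injective (trans (cong evens tf-merge) (odds-⇑ m))

  alternate-ft : ¬ Alternate (⇑ xs) (0 ∷ ⇑ ys)
  alternate-ft (odds≡ , _) = 0∷≢⇑ xs (trans (sym (cong odds ft-merge)) odds≡)

  alternate-ff : Alternate (⇑ xs) (⇑ ys) ⇔ Alternate xs ys
  alternate-ff =
    cancel⇔ ⇑-injective (trans (cong odds ff-merge) (odds-⇑ m)) ×-⇔
    cancel⇔ ⇑-injective (trans (cong evens ff-merge) (evens-⇑ m))

  alternate′-tt : Alternate′ (0 ∷ ⇑ xs) (0 ∷ ⇑ ys) ⇔ Alternate′ xs ys
  alternate′-tt =
    cancel⇔ 0∷⇑-injective (trans (cong evens tt-merge) (cong (0 ∷_) (evens-⇑ m))) ×-⇔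
    cancel⇔ 0∷⇑-injective (trans (cong odds tt-merge) (cong (0 ∷_) (odds-⇑ m)))

  alternate′-tf : ¬ Alternate′ (0 ∷ ⇑ xs) (⇑ ys)
  alternate′-tf (evens≡ , _) = 0∷≢⇑ (odds m) (trans (sym evens≡) (trans (cong evens tf-merge) (odds-⇑ m)))

  alternate′-ft : Alternate′ (⇑ xs) (0 ∷ ⇑ ys) ⇔ Alternate xs ys
  alternate′-ft =
    cancel⇔ ⇑-injective (trans (cong evens ft-merge) (odds-⇑ m)) ×-⇔
    cancel⇔ 0∷⇑-injective (trans (cong odds ft-merge) (cong (0 ∷_) (evens-⇑ m)))

  alternate′-ff : Alternate′ (⇑ xs) (⇑ ys) ⇔ Alternate′ xs ys
  alternate′-ff =
    cancel⇔ ⇑-injective (trans (cong evens ff-merge) (evens-⇑ m)) ×-⇔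
    cancel⇔ ⇑-injective (trans (cong odds ff-merge) (odds-⇑ m))

private
  toℕ-filter-suc : ∀ {n} b (I : Subset n) L →
    map toℕ (filter (_∈? (b ∷ I)) (map Fin.suc L)) ≡ ⇑ (map toℕ (filter (_∈? I) L))
  toℕ-filter-suc b I [] = refl
  toℕ-filter-suc b I (x ∷ L) with x ∈? I
  ... | yes _ = cong (suc (toℕ x) ∷_) (toℕ-filter-suc b I L)
  ... | no _ = toℕ-filter-suc b I L

  elems-∷ : ∀ {n} b (I : Subset n) → map toℕ (filter (_∈? (b ∷ I)) (List.tabulate Fin.suc)) ≡ ⇑ (elems I)
  elems-∷ b I = trans (cong (map toℕ ∘ filter (_∈? (b ∷ I))) (sym (Listₚ.map-tabulate id Fin.suc)))
    (toℕ-filter-suc b I (List.allFin _))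

  elems-true : ∀ {n} (I : Subset n) → elems (true ∷ I) ≡ 0 ∷ ⇑ (elems I)
  elems-true I = cong (0 ∷_) (elems-∷ true I)

  elems-false : ∀ {n} (I : Subset n) → elems (false ∷ I) ≡ ⇑ (elems I)
  elems-false I = elems-∷ false I

  subst₂-⇔ : ∀ (R : List ℕ → List ℕ → Set) {xs xs′ ys ys′} → xs ≡ xs′ → ys ≡ ys′ → R xs ys ⇔ R xs′ ys′
  subst₂-⇔ R refl refl = ⇔-refl

alternate⇔alt₀ : ∀ {m} (I J : Subset m) → Alternate (elems I) (elems J) ⇔ Alt₀ I J
alternate′⇔alt₁ : ∀ {m} (I J : Subset m) → Alternate′ (elems I) (elems J) ⇔ Alt₁ I J
alternate⇔alt₀ [] [] = mk⇔ _ λ _ → refl , refl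
alternate⇔alt₀ (true ∷ I) (true ∷ J) =
  ⇔-trans (subst₂-⇔ Alternate (elems-true I) (elems-true J)) (⇔-trans (alternate-tt _ _) (alternate⇔alt₀ I J))
alternate⇔alt₀ (true ∷ I) (false ∷ J) =
  ⇔-trans (subst₂-⇔ Alternate (elems-true I) (elems-false J)) (⇔-trans (alternate-tf _ _) (alternate′⇔alt₁ I J))
alternate⇔alt₀ (false ∷ I) (true ∷ J) =
  ⇔-trans (subst₂-⇔ Alternate (elems-false I) (elems-true J)) (mk⇔ (alternate-ft _ _) ⊥-elim)
alternate⇔alt₀ (false ∷ I) (false ∷ J) =
  ⇔-trans (subst₂-⇔ Alternate (elems-false I) (elems-false J)) (⇔-trans (alternate-ff _ _) (alternate⇔alt₀ I J))
alternate′⇔alt₁ [] [] = mk⇔ _ λ _ → refl , refl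
alternate′⇔alt₁ (true ∷ I) (true ∷ J) =
  ⇔-trans (subst₂-⇔ Alternate′ (elems-true I) (elems-true J)) (⇔-trans (alternate′-tt _ _) (alternate′⇔alt₁ I J))
alternate′⇔alt₁ (true ∷ I) (false ∷ J) =
  ⇔-trans (subst₂-⇔ Alternate′ (elems-true I) (elems-false J)) (mk⇔ (alternate′-tf _ _) ⊥-elim)
alternate′⇔alt₁ (false ∷ I) (true ∷ J) =
  ⇔-trans (subst₂-⇔ Alternate′ (elems-false I) (elems-true J)) (⇔-trans (alternate′-ft _ _) (alternate⇔alt₀ I J))
alternate′⇔alt₁ (false ∷ I) (false ∷ J) =
  ⇔-trans (subst₂-⇔ Alternate′ (elems-false I) (elems-false J)) (⇔-trans (alternate′-ff _ _) (alternate′⇔alt₁ I J))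

sortedPair⇔leads : ∀ {m} (I J : Subset m) → SortedPair I J ⇔ Leads 0 I J
sortedPair⇔leads I J = ⇔-trans (alternate⇔alt₀ I J) (mk⇔ (alt₀⇒leads I J) (leads⇒alt₀ I J))

circuitSimplex-kSubset : ∀ {n k} {T : Subset n → Set} → IsCircuitSimplex k T → ∀ {I} → T I → ∣ I ∣ ≡ k
circuitSimplex-kSubset {k = k} (_ , g , (g-kSubset , _) , _ , T⊆g) {I} I∈T = from-index (T⊆g I I∈T)
  where
  from-index : (∃ λ a → g a ≡ I) → ∣ I ∣ ≡ k
  from-index (a , refl) = g-kSubset a

circuitSimplex-comparable : ∀ {n k} {T : Subset n → Set} → IsCircuitSimplex k T →
  ∀ {I J} → T I → T J → Leads 0 I J ⊎ Leads 0 J I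
circuitSimplex-comparable (_ , g , (_ , g-sorted) , _ , T⊆g) {I} {J} I∈T J∈T = compare (T⊆g I I∈T) (T⊆g J J∈T)
  where
  compare : (∃ λ a → g a ≡ I) → (∃ λ b → g b ≡ J) → Leads 0 I J ⊎ Leads 0 J I
  compare (a , refl) (b , refl) with <-cmp (toℕ a) (toℕ b)
  ... | tri< a<b _ _ = inj₁ (Equivalence.to (sortedPair⇔leads (g a) (g b)) (g-sorted a b a<b))
  ... | tri≈ _ a≡b _ = inj₁ (subst (λ c → Leads 0 (g a) (g c)) (Finₚ.toℕ-injective a≡b) (leads-refl (g a)))
  ... | tri> _ _ b<a = inj₂ (Equivalence.to (sortedPair⇔leads (g b) (g a)) (g-sorted b a b<a))

-- Quotients and maxima

module _ (n : ℕ) .{{_ : NonZero n}} where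

  quotient-unique : ∀ a m → a * n ≤ m → m < a * n + n → m / n ≡ a
  quotient-unique a m lo hi = ≤-antisym
    (s≤s⁻¹ (m<n*o⇒m/o<n (subst (m <_) (+-comm (a * n) n) hi)))
    (subst (_≤ m / n) (m*n/n≡m a n) (/-monoˡ-≤ n lo))

  ≤/⇒*≤ : ∀ {a} m → a ≤ m / n → a * n ≤ m
  ≤/⇒*≤ {a} m a≤m/n = ≤-trans (*-monoˡ-≤ n a≤m/n) (m/n*n≤m m n)

  /<⇒<* : ∀ {a} m → m / n < a → m < a * n
  /<⇒<* {a} m m/n<a = begin-strict
    m                  ≡⟨ m≡m%n+[m/n]*n m n ⟩
    m % n + m / n * n  <⟨ +-monoˡ-< (m / n * n) (m%n<n m n) ⟩
    n + m / n * n      ≤⟨ *-monoˡ-≤ n m/n<a ⟩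
    a * n              ∎
    where open ≤-Reasoning

bounded-argmax : (g : ℕ → ℕ) (m : ℕ) → ∃ λ c* → c* ≤ m × ∀ {c} → c ≤ m → g c ≤ g c*
bounded-argmax g m = c* , argmax-all g (z≤n {m}) (All.tabulate (s≤s⁻¹ ∘ ∈-upTo⁻)) ,
  λ c≤m → All.lookup (f[xs]≤f[argmax] {f = g} 0 (upTo (suc m))) (∈-upTo⁺ (s≤s c≤m))
  where
  open Data.List.Extrema ≤-totalOrder using (argmax; argmax-all; f[xs]≤f[argmax])
  c* = argmax g 0 (upTo (suc m))

-- Circular distance and stability

cd-sym : ∀ {n} (i j : Fin n) → cd i j ≡ cd j i
cd-sym {n} i j = cong (λ d → d ⊓ (n ∸ d)) (∣-∣-comm (toℕ i) (toℕ j))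

module _ {n r : ℕ} {i j : Fin n} (i<j : toℕ i < toℕ j) where
  private
    d = toℕ j ∸ toℕ i

    j≡d+i : toℕ j ≡ d + toℕ i
    j≡d+i = sym (m∸n+n≡m (<⇒≤ i<j))

    cd≡ : cd i j ≡ d ⊓ (n ∸ d)
    cd≡ = cong (λ e → e ⊓ (n ∸ e)) (m≤n⇒∣m-n∣≡n∸m (<⇒≤ i<j))

    d≤n : d ≤ n
    d≤n = ≤-trans (m∸n≤m (toℕ j) (toℕ i)) (<⇒≤ (Finₚ.toℕ<n j))

    forward≡ : toℕ i + r ≡ r + toℕ i
    forward≡ = +-comm (toℕ i) r

    backward≡ : toℕ j + r ≡ r + d + toℕ i
    backward≡ = trans (cong (_+ r) j≡d+i) (xy∙z≈zx∙y d (toℕ i) r)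
    
  ≤cd⇒gaps : r ≤ cd i j → toℕ i + r ≤ toℕ j × toℕ j + r ≤ n + toℕ i
  ≤cd⇒gaps r≤cd = forward , backward
    where
    r≤ = subst (r ≤_) cd≡ r≤cd
    forward : toℕ i + r ≤ toℕ j
    forward = subst₂ _≤_ (sym forward≡) (sym j≡d+i) (+-monoˡ-≤ (toℕ i) (≤-trans r≤ (m⊓n≤m _ _)))
    backward : toℕ j + r ≤ n + toℕ i
    backward = subst (_≤ n + toℕ i) (sym backward≡)
      (+-monoˡ-≤ (toℕ i) (m≤o∸n⇒m+n≤o r d≤n (≤-trans r≤ (m⊓n≤n _ _))))

  gaps⇒≤cd : toℕ i + r ≤ toℕ j → toℕ j + r ≤ n + toℕ i → r ≤ cd i j
  gaps⇒≤cd forward backward = subst (r ≤_) (sym cd≡) (⊓-glb r≤d r≤n∸d)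
    where
    r≤d : r ≤ d
    r≤d = +-cancelʳ-≤ (toℕ i) r d (subst₂ _≤_ forward≡ j≡d+i forward)
    r≤n∸d : r ≤ n ∸ d
    r≤n∸d = m+n≤o⇒m≤o∸n r (+-cancelʳ-≤ (toℕ i) (r + d) n (subst (_≤ n + toℕ i) backward≡ backward))

stable-by-order : ∀ {n r} {I : Subset n} →
  (∀ {i j} → i ∈ I → j ∈ I → toℕ i < toℕ j → r ≤ cd i j) → IsStable r I
stable-by-order ordered i j i∈ j∈ i≢j with <-cmp (toℕ i) (toℕ j)
... | tri< i<j _ _ = ordered i∈ j∈ i<j
... | tri≈ _ i≡j _ = ⊥-elim (i≢j (Finₚ.toℕ-injective i≡j))
... | tri> _ _ j<i = subst (_ ≤_) (cd-sym j i) (ordered j∈ i∈ j<i)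

stable⇒gaps : ∀ {n g} {I : Subset n} → IsStable g I →
  ∀ {x y} → x < y → Jump (count I) x → Jump (count I) y → x + g ≤ y × y + g ≤ n + x
stable⇒gaps {I = I} stable {x} {y} x<y jump-x jump-y =
  subst₂ (λ a b → a + _ ≤ b × b + _ ≤ _ + a) (Finₚ.toℕ-fromℕ< x<n) (Finₚ.toℕ-fromℕ< y<n)
    (≤cd⇒gaps i<j (stable i j (jump⇒∈ I x<n jump-x) (jump⇒∈ I y<n jump-y) (<⇒≢ i<j ∘ cong toℕ)))
  where
  x<n = jump⇒< I jump-x
  y<n = jump⇒< I jump-y
  i = fromℕ< x<n
  j = fromℕ< y<n
  i<j : toℕ i < toℕ j
  i<j = subst₂ _<_ (sym (Finₚ.toℕ-fromℕ< x<n)) (sym (Finₚ.toℕ-fromℕ< y<n)) x<y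

stable⇒gapped : ∀ {n g} {I : Subset n} → IsStable g I → Gapped g (count I)
stable⇒gapped stable x<y jump-x jump-y = proj₁ (stable⇒gaps stable x<y jump-x jump-y)

-- Linear algebra over ℚ

fromℤ-injective : ∀ {a b} → fromℤ a ≡ fromℤ b → a ≡ b
fromℤ-injective = cong ℚ.numerator

z/1≡fromℤ : ∀ z → z ℚ./ 1 ≡ fromℤ z
z/1≡fromℤ z = ℚₚ.↥p/↧p≡p (fromℤ z)

fromℤ-+ : ∀ a b → fromℤ (a ℤ.+ b) ≡ fromℤ a ℚ.+ fromℤ b
fromℤ-+ a b =
  ℚₚ.toℚᵘ-injective (ℚᵘₚ.≃-trans (*≡* cross) (ℚᵘₚ.≃-sym (ℚₚ.toℚᵘ-homo-+ (fromℤ a) (fromℤ b))))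
  where
  cross : (a ℤ.+ b) ℤ.* ℤ.+ 1 ≡ (a ℤ.* ℤ.+ 1 ℤ.+ b ℤ.* ℤ.+ 1) ℤ.* ℤ.+ 1
  cross = cong (ℤ._* ℤ.+ 1) (sym (cong₂ ℤ._+_ (ℤₚ.*-identityʳ a) (ℤₚ.*-identityʳ b)))

fromℤ-* : ∀ a b → fromℤ (a ℤ.* b) ≡ fromℤ a ℚ.* fromℤ b
fromℤ-* a b =
  ℚₚ.toℚᵘ-injective (ℚᵘₚ.≃-trans (*≡* refl) (ℚᵘₚ.≃-sym (ℚₚ.toℚᵘ-homo-* (fromℤ a) (fromℤ b))))

fromℤ-neg : ∀ a → fromℤ (ℤ.- a) ≡ ℚ.- fromℤ a
fromℤ-neg (ℤ.+ 0) = refl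
fromℤ-neg ℤ.+[1+ n ] = refl
fromℤ-neg ℤ.-[1+ n ] = refl

fromℤ-- : ∀ a b → fromℤ (a ℤ.- b) ≡ fromℤ a ℚ.- fromℤ b
fromℤ-- a b = trans (fromℤ-+ a (ℤ.- b)) (cong (fromℤ a ℚ.+_) (fromℤ-neg b))

*-fromℤ-+ : ∀ p a b → p ℚ.* fromℤ (ℤ.+ (a + b)) ≡ p ℚ.* fromℤ (ℤ.+ a) ℚ.+ p ℚ.* fromℤ (ℤ.+ b)
*-fromℤ-+ p a b = trans (cong (p ℚ.*_) (fromℤ-+ (ℤ.+ a) (ℤ.+ b))) (ℚₚ.*-distribˡ-+ p (fromℤ (ℤ.+ a)) (fromℤ (ℤ.+ b)))

fromℤ-χℤ : ∀ {n} (I : Subset n) c → fromℤ (χℤ I c) ≡ χ I c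
fromℤ-χℤ I c with lookup I c
... | true = refl
... | false = refl

χ≡fromℤ-bit : ∀ {n} (I : Subset n) c → χ I c ≡ fromℤ (ℤ.+ bit (lookup I c))
χ≡fromℤ-bit I c with lookup I c
... | true = refl
... | false = refl

Σℚ≡sum : ∀ {m} (f : Fin m → ℚ) → Σℚ f ≡ sum f
Σℚ≡sum {zero} f = refl
Σℚ≡sum {suc m} f = cong (f zero ℚ.+_) (Σℚ≡sum (f ∘ suc))

fromℤ-Σ : ∀ {m} (ν : Fin m → ℤ) → fromℤ (Σℤ ν) ≡ sum (fromℤ ∘ ν)
fromℤ-Σ {zero} ν = refl
fromℤ-Σ {suc m} ν = trans (fromℤ-+ (ν zero) (Σℤ (ν ∘ suc))) (cong (fromℤ (ν zero) ℚ.+_) (fromℤ-Σ (ν ∘ suc)))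

LinIndep : ∀ {m p} → (Fin m → Fin p → ℚ) → Set
LinIndep {m} v = (l : Fin m → ℚ) → (∀ c → sum (λ a → l a ℚ.* v a c) ≡ 0ℚ) → ∀ a → l a ≡ 0ℚ

module _ {m p} (v : Fin m → Fin (suc p) → ℚ) where

  linIndep-dropColumn : (∀ a → v a zero ≡ 0ℚ) → LinIndep v → LinIndep (λ a c → v a (suc c))
  linIndep-dropColumn first-column-zero indep l rest-zero = indep l λ where
    zero → trans (sum-cong-≗ λ a → trans (cong (l a ℚ.*_) (first-column-zero a)) (ℚₚ.*-zeroʳ (l a))) (sum-replicate-zero m)
    (suc c) → rest-zero c

module _ {m p} (v : Fin (suc m) → Fin (suc p) → ℚ) (i : Fin (suc m)) .{{_ : ℚ.NonZero (v i zero)}} where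
  private
    ratio : Fin m → ℚ
    ratio a = v (punchIn i a) zero ℚ.* ℚ.1/ v i zero

    ratio-spec : ∀ a → ratio a ℚ.* v i zero ≡ v (punchIn i a) zero
    ratio-spec a = trans (ℚₚ.*-assoc (v (punchIn i a) zero) (ℚ.1/ v i zero) (v i zero))
      (trans (cong (v (punchIn i a) zero ℚ.*_) (ℚₚ.*-inverseˡ (v i zero))) (ℚₚ.*-identityʳ _))

  eliminate : Fin m → Fin p → ℚ
  eliminate a c = v (punchIn i a) (suc c) ℚ.- ratio a ℚ.* v i (suc c)

  linIndep-eliminate : LinIndep v → LinIndep eliminate
  linIndep-eliminate indep l eliminated-zero a =
    trans (sym (insertAt-punchIn l i s a)) (indep (insertAt l i s) combination-zero (punchIn i a))
    where
    open ≡-Reasoning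
    open +-*-Solver
    s = sum λ a → ℚ.- (l a ℚ.* ratio a)
    Λ = insertAt l i s

    residual : ∀ c → s ℚ.* v i c ℚ.+ sum (λ a → l a ℚ.* v (punchIn i a) c)
                   ≡ sum (λ a → l a ℚ.* (v (punchIn i a) c ℚ.- ratio a ℚ.* v i c))
    residual c = begin
      s ℚ.* v i c ℚ.+ sum (λ a → l a ℚ.* v (punchIn i a) c)
        ≡⟨ ℚₚ.+-comm (s ℚ.* v i c) _ ⟩
      sum (λ a → l a ℚ.* v (punchIn i a) c) ℚ.+ s ℚ.* v i c
        ≡⟨ cong (sum (λ a → l a ℚ.* v (punchIn i a) c) ℚ.+_) (*-distribʳ-sum (v i c) (λ a → ℚ.- (l a ℚ.* ratio a))) ⟩
      sum (λ a → l a ℚ.* v (punchIn i a) c) ℚ.+ sum (λ a → ℚ.- (l a ℚ.* ratio a) ℚ.* v i c)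
        ≡⟨ ∑-distrib-+ (λ a → l a ℚ.* v (punchIn i a) c) (λ a → ℚ.- (l a ℚ.* ratio a) ℚ.* v i c) ⟨
      sum (λ a → l a ℚ.* v (punchIn i a) c ℚ.+ ℚ.- (l a ℚ.* ratio a) ℚ.* v i c)
        ≡⟨ sum-cong-≗ (λ a → solve 4 (λ l x r y → l :* x :+ (:- (l :* r)) :* y := l :* (x :- r :* y)) refl
                                 (l a) (v (punchIn i a) c) (ratio a) (v i c)) ⟩
      sum (λ a → l a ℚ.* (v (punchIn i a) c ℚ.- ratio a ℚ.* v i c)) ∎

    combination-zero : ∀ c → sum (λ b → Λ b ℚ.* v b c) ≡ 0ℚ
    combination-zero c = begin
      sum (λ b → Λ b ℚ.* v b c)
        ≡⟨ sum-remove {i = i} (λ b → Λ b ℚ.* v b c) ⟩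
      Λ i ℚ.* v i c ℚ.+ sum (λ a → Λ (punchIn i a) ℚ.* v (punchIn i a) c)
        ≡⟨ cong₂ ℚ._+_ (cong (ℚ._* v i c) (insertAt-lookup l i s))
                       (sum-cong-≗ λ a → cong (ℚ._* v (punchIn i a) c) (insertAt-punchIn l i s a)) ⟩
      s ℚ.* v i c ℚ.+ sum (λ a → l a ℚ.* v (punchIn i a) c)
        ≡⟨ residual c ⟩
      sum (λ a → l a ℚ.* (v (punchIn i a) c ℚ.- ratio a ℚ.* v i c))
        ≡⟨ remaining c ⟩
      0ℚ ∎
      where
      remaining : ∀ c → sum (λ a → l a ℚ.* (v (punchIn i a) c ℚ.- ratio a ℚ.* v i c)) ≡ 0ℚ
      remaining zero = trans (sum-cong-≗ cleared) (sum-replicate-zero m)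
        where
        cleared : ∀ a → l a ℚ.* (v (punchIn i a) zero ℚ.- ratio a ℚ.* v i zero) ≡ 0ℚ
        cleared a = begin
          l a ℚ.* (v (punchIn i a) zero ℚ.- ratio a ℚ.* v i zero)  ≡⟨ cong (λ x → l a ℚ.* (v (punchIn i a) zero ℚ.- x)) (ratio-spec a) ⟩
          l a ℚ.* (v (punchIn i a) zero ℚ.- v (punchIn i a) zero)  ≡⟨ cong (l a ℚ.*_) (ℚₚ.+-inverseʳ (v (punchIn i a) zero)) ⟩
          l a ℚ.* 0ℚ                                               ≡⟨ ℚₚ.*-zeroʳ (l a) ⟩
          0ℚ                                                       ∎
      remaining (suc c) = eliminated-zero c

linIndep⇒≤ : ∀ {m p} (v : Fin m → Fin p → ℚ) → LinIndep v → m ≤ p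
linIndep⇒≤ {zero} v _ = z≤n
linIndep⇒≤ {suc m} {zero} v indep = ⊥-elim (ℚₚ.1≢0 (indep (λ _ → 1ℚ) (λ ()) zero))
linIndep⇒≤ {suc m} {suc p} v indep with Finₚ.any? (λ a → ¬? (v a zero ℚₚ.≟ 0ℚ))
... | yes (i , v[i,0]≢0) = s≤s (linIndep⇒≤ (eliminate v i) (linIndep-eliminate v i indep))
  where instance _ = ℚ.≢-nonZero v[i,0]≢0
... | no no-pivot = m≤n⇒m≤1+n (linIndep⇒≤ (λ a c → v a (suc c))
  (linIndep-dropColumn v (λ a → decidable-stable (v a zero ℚₚ.≟ 0ℚ) λ ≢0 → no-pivot (a , ≢0)) indep))

sum-χ : ∀ {p} (I : Subset p) → sum (χ I) ≡ fromℤ (ℤ.+ ∣ I ∣)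
sum-χ [] = refl
sum-χ (true ∷ I) = trans (cong (1ℚ ℚ.+_) (sum-χ I)) (sym (fromℤ-+ (ℤ.+ 1) (ℤ.+ ∣ I ∣)))
sum-χ (false ∷ I) = trans (ℚₚ.+-identityˡ _) (sum-χ I)

affIndep⇒linIndep : ∀ {m p} (v : Fin m → Fin p → ℚ) K .{{_ : ℚ.NonZero K}} →
  (∀ a → sum (v a) ≡ K) → AffIndep v → LinIndep v
affIndep⇒linIndep {m} {p} v K row-sum affIndep l combination-zero =
  affIndep l (trans (Σℚ≡sum l) Σl≡0) (λ c → trans (Σℚ≡sum (λ a → l a ℚ.* v a c)) (combination-zero c))
  where
  open ≡-Reasoning
  K*Σl≡0 : K ℚ.* sum l ≡ 0ℚ
  K*Σl≡0 = begin
    K ℚ.* sum l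
      ≡⟨ *-distribˡ-sum K l ⟩
    sum (λ a → K ℚ.* l a)
      ≡⟨ sum-cong-≗ (λ a → trans (ℚₚ.*-comm K (l a)) (cong (l a ℚ.*_) (sym (row-sum a)))) ⟩
    sum (λ a → l a ℚ.* sum (v a))
      ≡⟨ sum-cong-≗ (λ a → *-distribˡ-sum (l a) (v a)) ⟩
    sum (λ a → sum (λ c → l a ℚ.* v a c))
      ≡⟨ ∑-comm (λ a c → l a ℚ.* v a c) ⟩
    sum (λ c → sum (λ a → l a ℚ.* v a c))
      ≡⟨ sum-cong-≗ {p} combination-zero ⟩
    sum {p} (λ _ → 0ℚ)
      ≡⟨ sum-replicate-zero p ⟩
    0ℚ ∎
  Σl≡0 : sum l ≡ 0ℚ
  Σl≡0 = begin
    sum l                     ≡⟨ ℚₚ.*-identityˡ (sum l) ⟨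
    1ℚ ℚ.* sum l              ≡⟨ cong (ℚ._* sum l) (ℚₚ.*-inverseˡ K) ⟨
    ℚ.1/ K ℚ.* K ℚ.* sum l    ≡⟨ ℚₚ.*-assoc (ℚ.1/ K) K (sum l) ⟩
    ℚ.1/ K ℚ.* (K ℚ.* sum l)  ≡⟨ cong (ℚ.1/ K ℚ.*_) K*Σl≡0 ⟩
    ℚ.1/ K ℚ.* 0ℚ             ≡⟨ ℚₚ.*-zeroʳ (ℚ.1/ K) ⟩
    0ℚ                        ∎

affIndep-kSubsets⇒≤ : ∀ {m p k′} (f : Fin m → Subset p) → (∀ a → ∣ f a ∣ ≡ suc k′) →
  AffIndep (χ ∘ f) → m ≤ p
affIndep-kSubsets⇒≤ {k′ = k′} f ∣f∣≡1+k′ affIndep =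
  linIndep⇒≤ (χ ∘ f) (affIndep⇒linIndep (χ ∘ f) (fromℤ (ℤ.+ suc k′)) row-sum affIndep)
  where
  row-sum : ∀ a → sum (χ (f a)) ≡ fromℤ (ℤ.+ suc k′)
  row-sum a = trans (sum-χ (f a)) (cong (fromℤ ∘ ℤ.+_) (∣f∣≡1+k′ a))

prefixSum : ∀ {m} → (Fin m → ℚ) → ℕ → ℚ
prefixSum f zero = 0ℚ
prefixSum {zero} f (suc b) = 0ℚ
prefixSum {suc m} f (suc b) = f zero ℚ.+ prefixSum (f ∘ suc) b

prefixSum-suc-toℕ : ∀ {m} (f : Fin m → ℚ) a → prefixSum f (suc (toℕ a)) ≡ prefixSum f (toℕ a) ℚ.+ f a
prefixSum-suc-toℕ f zero = trans (ℚₚ.+-identityʳ (f zero)) (sym (ℚₚ.+-identityˡ (f zero)))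
prefixSum-suc-toℕ f (suc a) =
  trans (cong (f zero ℚ.+_) (prefixSum-suc-toℕ (f ∘ suc) a)) (sym (ℚₚ.+-assoc (f zero) _ (f (suc a))))

f≡Δ-prefixSum : ∀ {m} (f : Fin m → ℚ) a → f a ≡ prefixSum f (suc (toℕ a)) ℚ.- prefixSum f (toℕ a)
f≡Δ-prefixSum f a = begin
  f a                                                  ≡⟨ solve 2 (λ p x → x := p :+ x :- p) refl (prefixSum f (toℕ a)) (f a) ⟩
  prefixSum f (toℕ a) ℚ.+ f a ℚ.- prefixSum f (toℕ a)  ≡⟨ cong (ℚ._- prefixSum f (toℕ a)) (prefixSum-suc-toℕ f a) ⟨
  prefixSum f (suc (toℕ a)) ℚ.- prefixSum f (toℕ a)    ∎
  where
  open ≡-Reasoning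
  open +-*-Solver

prefixSum-zero : ∀ {m} c → prefixSum {m} (λ _ → 0ℚ) c ≡ 0ℚ
prefixSum-zero zero = refl
prefixSum-zero {zero} (suc c) = refl
prefixSum-zero {suc m} (suc c) = trans (ℚₚ.+-identityˡ _) (prefixSum-zero {m} c)

prefixSum-indicator : ∀ {m} (f : Fin m → ℚ) b → sum (λ a → f a ℚ.* fromℤ (ℤ.+ bit (toℕ a <ᵇ b))) ≡ prefixSum f b
prefixSum-indicator {zero} f zero = refl
prefixSum-indicator {zero} f (suc b) = refl
prefixSum-indicator {suc m} f zero = trans (sum-cong-≗ (ℚₚ.*-zeroʳ ∘ f)) (sum-replicate-zero (suc m))
prefixSum-indicator {suc m} f (suc b) = cong₂ ℚ._+_ (ℚₚ.*-identityʳ (f zero)) (prefixSum-indicator (f ∘ suc) b)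

prefixSum-unique : ∀ {m} (F : ℕ → ℚ) (f : Fin m → ℚ) → F 0 ≡ 0ℚ →
  (∀ a → F (suc (toℕ a)) ≡ F (toℕ a) ℚ.+ f a) → ∀ {c} → c ≤ m → F c ≡ prefixSum f c
prefixSum-unique F f F0≡0 step {zero} _ = F0≡0
prefixSum-unique F f F0≡0 step {suc c} c<m = begin
  F (suc c)                    ≡⟨ cong (F ∘ suc) toℕa≡c ⟨
  F (suc (toℕ a))              ≡⟨ step a ⟩
  F (toℕ a) ℚ.+ f a            ≡⟨ cong (λ x → F x ℚ.+ f a) toℕa≡c ⟩
  F c ℚ.+ f a                  ≡⟨ cong (ℚ._+ f a) (prefixSum-unique F f F0≡0 step (<⇒≤ c<m)) ⟩
  prefixSum f c ℚ.+ f a        ≡⟨ cong (λ x → prefixSum f x ℚ.+ f a) toℕa≡c ⟨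
  prefixSum f (toℕ a) ℚ.+ f a  ≡⟨ prefixSum-suc-toℕ f a ⟨
  prefixSum f (suc (toℕ a))    ≡⟨ cong (prefixSum f ∘ suc) toℕa≡c ⟩
  prefixSum f (suc c)          ∎
  where
  open ≡-Reasoning
  a = fromℕ< c<m
  toℕa≡c = Finₚ.toℕ-fromℕ< c<m

Integral : ℚ → Set
Integral p = ∃ λ z → fromℤ z ≡ p

integral-- : ∀ {p p′} → Integral p → Integral p′ → Integral (p ℚ.- p′)
integral-- (z , refl) (z′ , refl) = z ℤ.- z′ , fromℤ-- z z′

integral-prefixSum : ∀ {m} (z : Fin m → ℤ) c → Integral (prefixSum (fromℤ ∘ z) c)
integral-prefixSum z zero = ℤ.+ 0 , refl
integral-prefixSum {zero} z (suc c) = ℤ.+ 0 , refl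
integral-prefixSum {suc m} z (suc c) with Z , Z≡ ← integral-prefixSum (z ∘ suc) c =
  z zero ℤ.+ Z , trans (fromℤ-+ (z zero) Z) (cong (fromℤ (z zero) ℚ.+_) Z≡)

-- Mechanical words of slope k / n

module Slope (k′ q′ : ℕ) where

  k q n : ℕ
  k = suc k′
  q = suc q′
  n = suc (q * k)

  qk<n : q * k < n
  qk<n = n<1+n (q * k)

  k≤n : k ≤ n
  k≤n = ≤-trans (m≤n*m k q) (n≤1+n (q * k))

  coprime-n-k : Coprime n k
  coprime-n-k {d} (d∣n , d∣k) = ∣1⇒≡1 (∣m+n∣m⇒∣n (subst (d ∣_) (+-comm 1 (q * k)) d∣n) (∣-trans d∣k (n∣m*n q)))

  n∣d*k⇒d≡0∨d≡n : ∀ {d} → n ∣ d * k → d ≤ n → d ≡ 0 ⊎ d ≡ n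
  n∣d*k⇒d≡0∨d≡n {d} n∣dk d≤n with coprime-divisor coprime-n-k (subst (n ∣_) (*-comm d k) n∣dk)
  ... | divides zero d≡0 = inj₁ d≡0
  ... | divides (suc zero) d≡n = inj₂ (trans d≡n (+-identityʳ n))
  ... | divides (suc (suc p)) d≡[2+p]n = ⊥-elim (<⇒≱ (subst (n <_) (sym d≡[2+p]n) (m<m+n n (s≤s z≤n))) d≤n)

  level : ℕ → ℕ → ℕ
  level u c = (c * k + u) / n

  level-0 : ∀ {u} → u < n → level u 0 ≡ 0
  level-0 = m<n⇒m/n≡0

  level-+n : ∀ u c → level u (c + n) ≡ level u c + k
  level-+n u c = begin
    ((c + n) * k + u) / n    ≡⟨ cong (_/ n) (shift c u) ⟩
    (c * k + u + k * n) / n  ≡⟨ +-distrib-/-∣ʳ (c * k + u) (n∣m*n k) ⟩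
    level u c + k * n / n    ≡⟨ cong (level u c +_) (m*n/n≡m k n) ⟩
    level u c + k            ∎
    where
    open ≡-Reasoning
    shift : ∀ c u → (c + n) * k + u ≡ c * k + u + k * n
    shift = solve-∀

  level-n : ∀ {u} → u < n → level u n ≡ k
  level-n {u} u<n = trans (level-+n u 0) (cong (_+ k) (level-0 u<n))

  level-unitSteps : ∀ u → UnitSteps (level u)
  level-unitSteps u c = /-monoˡ-≤ n (+-monoˡ-≤ u (m≤n+m (c * k) k)) , s≤s⁻¹ (m<n*o⇒m/o<n {o = n} bound)
    where
    bound : suc c * k + u < suc (suc (level u c)) * n
    bound = begin-strict
      k + c * k + u            ≡⟨ +-assoc k (c * k) u ⟩
      k + (c * k + u)          <⟨ +-mono-≤-< k≤n (/<⇒<* n (c * k + u) (n<1+n (level u c))) ⟩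
      n + suc (level u c) * n  ∎
      where open ≤-Reasoning

  level-monoᵘ : ∀ {u u′} c → u ≤ u′ → level u c ≤ level u′ c
  level-monoᵘ c u≤u′ = /-monoˡ-≤ n (+-monoʳ-≤ (c * k) u≤u′)

  level-stepᵘ : ∀ {u u′} c → u′ ≤ u + n → level u′ c ≤ suc (level u c)
  level-stepᵘ {u} {u′} c u′≤u+n = s≤s⁻¹ (m<n*o⇒m/o<n {o = n} (begin-strict
    c * k + u′                 ≤⟨ +-monoʳ-≤ (c * k) u′≤u+n ⟩
    c * k + (u + n)            ≡⟨ +-assoc (c * k) u n ⟨
    c * k + u + n              <⟨ +-monoˡ-< n (/<⇒<* n (c * k + u) (n<1+n (level u c))) ⟩
    suc (level u c) * n + n    ≡⟨ +-comm (suc (level u c) * n) n ⟩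
    suc (suc (level u c)) * n  ∎))
    where open ≤-Reasoning

  level-gapped : ∀ u → Gapped q (level u)
  level-gapped u {x} {y} x<y jump-x jump-y = ≮⇒≥ λ y<x+q → <-irrefl refl (begin-strict
    suc (suc A) * n    ≤⟨ ≤/⇒*≤ n (suc y * k + u) (two-jumps {level u} (level-unitSteps u) x<y jump-x jump-y) ⟩
    suc y * k + u      ≤⟨ +-monoˡ-≤ u (*-monoˡ-≤ k y<x+q) ⟩
    (x + q) * k + u    ≡⟨ expand x q k u ⟩
    x * k + u + q * k  <⟨ +-monoˡ-< (q * k) (/<⇒<* n (x * k + u) (n<1+n A)) ⟩
    suc A * n + q * k  <⟨ +-monoʳ-< (suc A * n) qk<n ⟩
    suc A * n + n      ≡⟨ +-comm (suc A * n) n ⟩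
    suc (suc A) * n    ∎)
    where
    open ≤-Reasoning
    A = level u x
    expand : ∀ x q k u → (x + q) * k + u ≡ x * k + u + q * k
    expand = solve-∀

  jump-+n : ∀ u x → Jump (level u) x → Jump (level u) (x + n)
  jump-+n u x jump = begin
    level u (suc x + n)    ≡⟨ level-+n u (suc x) ⟩
    level u (suc x) + k    ≡⟨ cong (_+ k) jump ⟩
    suc (level u x + k)    ≡⟨ cong suc (level-+n u x) ⟨
    suc (level u (x + n))  ∎
    where open ≡-Reasoning

  n/k≡q : 2 ≤ k → n / k ≡ q
  n/k≡q 2≤k = quotient-unique k q n (n≤1+n (q * k)) (subst (suc n ≤_) (+-comm k (q * k)) (+-monoˡ-≤ (q * k) 2≤k))

  mechanical : ℕ → Subset n
  mechanical u = jumpsOf n (level u)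

  module _ {u : ℕ} (u<n : u < n) where

    count-mechanical : ∀ {c} → c ≤ n → count (mechanical u) c ≡ level u c
    count-mechanical {c} c≤n = trans (sym (+-identityʳ _))
      (trans (cong (count (mechanical u) c +_) (sym (level-0 u<n))) (count-jumpsOf n (level-unitSteps u) c≤n))

    ∣mechanical∣ : ∣ mechanical u ∣ ≡ k
    ∣mechanical∣ = trans (∣v∣≡count (mechanical u)) (trans (count-mechanical ≤-refl) (level-n u<n))

    ∈mechanical⇒jump : ∀ {i} → i ∈ mechanical u → Jump (level u) (toℕ i)
    ∈mechanical⇒jump {i} i∈ = begin
      level u (suc (toℕ i))               ≡⟨ count-mechanical (Finₚ.toℕ<n i) ⟨
      count (mechanical u) (suc (toℕ i))  ≡⟨ ∈⇒jump (mechanical u) i∈ ⟩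
      suc (count (mechanical u) (toℕ i))  ≡⟨ cong suc (count-mechanical (<⇒≤ (Finₚ.toℕ<n i))) ⟩
      suc (level u (toℕ i))               ∎
      where open ≡-Reasoning

    -- The wrap-around gap from j back to i is the gap between the jumps at j and i + n.
    mechanical-stable : ∀ {r} → r ≤ n / k → IsStable r (mechanical u)
    mechanical-stable {r} r≤n/k = stable-by-order λ {i} {j} i∈ j∈ i<j →
      let jump-i = ∈mechanical⇒jump i∈
          jump-j = ∈mechanical⇒jump j∈
          2≤k = ≤-trans (≤-trans (s≤s (s≤s z≤n)) (two-jumps {level u} (level-unitSteps u) i<j jump-i jump-j))
                  (subst (level u (suc (toℕ j)) ≤_) (level-n u<n) (unitSteps⇒mono (level-unitSteps u) (Finₚ.toℕ<n j)))
          r≤q = subst (r ≤_) (n/k≡q 2≤k) r≤n/k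
      in gaps⇒≤cd i<j (≤-trans (+-monoʳ-≤ (toℕ i) r≤q) (level-gapped u i<j jump-i jump-j))
           (≤-trans (+-monoʳ-≤ (toℕ j) r≤q)
             (subst (toℕ j + q ≤_) (+-comm (toℕ i) n)
               (level-gapped u (<-≤-trans (Finₚ.toℕ<n j) (m≤n+m n (toℕ i))) jump-j (jump-+n u (toℕ i) jump-i))))

  mechanical-stableKSubset : ∀ {u r} → u < n → r ≤ n / k → StableKSubset k r (mechanical u)
  mechanical-stableKSubset u<n r≤n/k = ∣mechanical∣ u<n , mechanical-stable u<n r≤n/k

  mechanical-leads : ∀ {u u′} → u′ ≤ u → u < n → Leads 0 (mechanical u) (mechanical u′)
  mechanical-leads {u} {u′} u′≤u u<n = leads-upTo (mechanical u) (mechanical u′) λ c c≤n →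
    subst₂ (λ a b → a ≤ b × b ≤ suc a)
      (sym (count-mechanical (≤-<-trans u′≤u u<n) c≤n)) (sym (count-mechanical u<n c≤n))
      (level-monoᵘ c u′≤u , level-stepᵘ c (≤-trans (<⇒≤ u<n) (m≤n+m n u′)))

  Balanced : (ℕ → ℕ) → Set
  Balanced G = ∀ {c₁ c₂} → c₁ ≤ n → c₂ ≤ n → n * G c₁ + c₂ * k ≤ n * G c₂ + c₁ * k + q * k

  window-balanced : ∀ {P} → UnitSteps P → Gapped q P →
    ∀ c L → P (c + L) ≤ P c + k → n * P (c + L) ≤ n * P c + L * k + q * k
  window-balanced {P} steps gapped c L P[c+L]≤Pc+k
    with m , Pc+m≡P[c+L] ← m≤n⇒∃[o]m+o≡n (unitSteps⇒mono steps (m≤m+n c L)) = begin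
    n * P (c + L)              ≡⟨ cong (n *_) Pc+m≡P[c+L] ⟨
    n * (P c + m)              ≡⟨ *-distribˡ-+ n (P c) m ⟩
    n * P c + n * m            ≤⟨ +-monoʳ-≤ (n * P c) (bound m Pc+m≡P[c+L]) ⟩
    n * P c + (L * k + q * k)  ≡⟨ +-assoc (n * P c) (L * k) (q * k) ⟨
    n * P c + L * k + q * k    ∎
    where
    open ≤-Reasoning
    expand : ∀ q k j → (1 + q * k) * (1 + j) ≡ j * q * k + (1 + j) + q * k
    expand = solve-∀
    collect : ∀ q k j → j * q * k + k + q * k ≡ (1 + j * q) * k + q * k
    collect = solve-∀
    bound : ∀ m → P c + m ≡ P (c + L) → n * m ≤ L * k + q * k
    bound zero _ = ≤-trans (≤-reflexive (*-zeroʳ n)) z≤n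
    bound (suc j) Pc+1+j≡P[c+L] = begin
      n * suc j                  ≡⟨ expand q k j ⟩
      j * q * k + suc j + q * k  ≤⟨ +-monoˡ-≤ (q * k) (+-monoʳ-≤ (j * q * k) 1+j≤k) ⟩
      j * q * k + k + q * k      ≡⟨ collect q k j ⟩
      suc (j * q) * k + q * k    ≤⟨ +-monoˡ-≤ (q * k) (*-monoˡ-≤ k jq<L) ⟩
      L * k + q * k              ∎
      where
      jq<L : j * q < L
      jq<L = window-length steps gapped j (≤-reflexive Pc+1+j≡P[c+L])
      1+j≤k : suc j ≤ k
      1+j≤k = +-cancelˡ-≤ (P c) (suc j) k (subst (_≤ P c + k) (sym Pc+1+j≡P[c+L]) P[c+L]≤Pc+k)

  q≤n : q ≤ n
  q≤n = ≤-trans (m≤m*n q k) (n≤1+n (q * k))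

  -- I ++ I runs twice around the n-gon: its gaps include the wrap-around gaps of I.
  module _ {I : Subset n} where

    doubled-jump : ∀ {x} → Jump (count (I ++ I)) x →
      (x < n × Jump (count I) x) ⊎ ∃ λ d → x ≡ n + d × Jump (count I) d
    doubled-jump {x} jump with x <? n
    ... | yes x<n = inj₁ (x<n , trans (sym (count-++ˡ I I x<n)) (trans jump (cong suc (count-++ˡ I I (<⇒≤ x<n)))))
    ... | no x≮n with d , refl ← m≤n⇒∃[o]m+o≡n (≮⇒≥ x≮n) = inj₂ (d , refl , +-cancelˡ-≡ (count I n) _ _ (begin
      count I n + count I (suc d)   ≡⟨ count-++ʳ I I (suc d) ⟨
      count (I ++ I) (n + suc d)    ≡⟨ cong (count (I ++ I)) (+-suc n d) ⟩
      count (I ++ I) (suc (n + d))  ≡⟨ jump ⟩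
      suc (count (I ++ I) (n + d))  ≡⟨ cong suc (count-++ʳ I I d) ⟩
      suc (count I n + count I d)   ≡⟨ +-suc (count I n) (count I d) ⟨
      count I n + suc (count I d)   ∎))
      where open ≡-Reasoning

    doubled-gapped : IsStable q I → Gapped q (count (I ++ I))
    doubled-gapped stable {x} {y} x<y jump-x jump-y with doubled-jump jump-x | doubled-jump jump-y
    ... | inj₁ (_ , jx) | inj₁ (_ , jy) = stable⇒gapped stable x<y jx jy
    ... | inj₁ (_ , jx) | inj₂ (d , refl , jd) with d <? x
    ...   | yes d<x = proj₂ (stable⇒gaps stable d<x jd jx)
    ...   | no d≮x = subst (x + q ≤_) (+-comm d n) (+-mono-≤ (≮⇒≥ d≮x) q≤n)
    doubled-gapped stable {y = y} x<y _ _ | inj₂ (d , refl , _) | inj₁ (y<n , _) =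
      ⊥-elim (<-asym (<-≤-trans y<n (m≤m+n n d)) x<y)
    doubled-gapped stable x<y _ _ | inj₂ (d , refl , jd) | inj₂ (e , refl , je) =
      subst (_≤ n + e) (sym (+-assoc n d q)) (+-monoʳ-≤ n (stable⇒gapped stable (+-cancelˡ-< n d e x<y) jd je))

  module _ {I : Subset n} (stable : IsStable q I) (∣I∣≡k : ∣ I ∣ ≡ k) where
    private
      open ≤-Reasoning

      P = count I

      Pn≡k : P n ≡ k
      Pn≡k = trans (sym (∣v∣≡count I)) ∣I∣≡k

      regroup : ∀ a L k b c → a + L * k + b + c * k ≡ a + (c + L) * k + b
      regroup = solve-∀

      balanced-ordered : ∀ {c L} → c + L ≤ n → n * P (c + L) + c * k ≤ n * P c + (c + L) * k + q * k
      balanced-ordered {c} {L} c+L≤n = begin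
        n * P (c + L) + c * k            ≤⟨ +-monoˡ-≤ (c * k) inequality ⟩
        n * P c + L * k + q * k + c * k  ≡⟨ regroup (n * P c) L k (q * k) c ⟩
        n * P c + (c + L) * k + q * k    ∎
        where
        inequality : n * P (c + L) ≤ n * P c + L * k + q * k
        inequality = window-balanced (count-unitSteps I) (stable⇒gapped stable) c L
          (≤-trans (subst (P (c + L) ≤_) Pn≡k (unitSteps⇒mono (count-unitSteps I) c+L≤n)) (m≤n+m k (P c)))

      -- The window [c₂, n + c₁) of I ++ I wraps around the n-gon.
      balanced-wrapped : ∀ {c₁ c₂ L} → c₁ < c₂ → c₂ ≤ n → c₂ + L ≡ n + c₁ →
        n * P c₁ + c₂ * k ≤ n * P c₂ + c₁ * k + q * k
      balanced-wrapped {c₁} {c₂} {L} c₁<c₂ c₂≤n c₂+L≡n+c₁ = +-cancelˡ-≤ (n * k) _ _ (begin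
        n * k + (n * P c₁ + c₂ * k)          ≡⟨ regroup₁ n k (P c₁) (c₂ * k) ⟩
        n * (k + P c₁) + c₂ * k              ≤⟨ +-monoˡ-≤ (c₂ * k) inequality ⟩
        n * P c₂ + L * k + q * k + c₂ * k    ≡⟨ regroup (n * P c₂) L k (q * k) c₂ ⟩
        n * P c₂ + (c₂ + L) * k + q * k      ≡⟨ cong (λ c → n * P c₂ + c * k + q * k) c₂+L≡n+c₁ ⟩
        n * P c₂ + (n + c₁) * k + q * k      ≡⟨ regroup₂ (n * P c₂) n c₁ k (q * k) ⟩
        n * k + (n * P c₂ + c₁ * k + q * k)  ∎)
        where
        regroup₁ : ∀ n k p b → n * k + (n * p + b) ≡ n * (k + p) + b
        regroup₁ = solve-∀
        regroup₂ : ∀ a n c k b → a + (n + c) * k + b ≡ n * k + (a + c * k + b)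
        regroup₂ = solve-∀
        D = count (I ++ I)
        D-high : D (c₂ + L) ≡ k + P c₁
        D-high = trans (cong D c₂+L≡n+c₁) (trans (count-++ʳ I I c₁) (cong (_+ P c₁) Pn≡k))
        D-low : D c₂ ≡ P c₂
        D-low = count-++ˡ I I c₂≤n
        inequality : n * (k + P c₁) ≤ n * P c₂ + L * k + q * k
        inequality = subst₂ (λ a b → n * a ≤ n * b + L * k + q * k) D-high D-low
          (window-balanced (count-unitSteps (I ++ I)) (doubled-gapped stable) c₂ L
            (subst₂ (λ a b → a ≤ b + k) (sym D-high) (sym D-low)
              (subst (_≤ P c₂ + k) (+-comm (P c₁) k)
                (+-monoˡ-≤ k (unitSteps⇒mono (count-unitSteps I) (<⇒≤ c₁<c₂))))))

    stable⇒balanced : Balanced (count I)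
    stable⇒balanced {c₁} {c₂} c₁≤n c₂≤n with c₂ ≤? c₁
    ... | yes c₂≤c₁ with L , refl ← m≤n⇒∃[o]m+o≡n c₂≤c₁ = balanced-ordered {c₂} {L} c₁≤n
    ... | no c₂≰c₁ with L , c₂+L≡n+c₁ ← m≤n⇒∃[o]m+o≡n (≤-trans c₂≤n (m≤m+n n c₁)) =
      balanced-wrapped (≰⇒> c₂≰c₁) c₂≤n c₂+L≡n+c₁

  module _ {I : Subset n} (balanced : Balanced (count I)) (Pn≡k : count I n ≡ k) where
    private
      P = count I

      -- P c = ⌊(c k + u) / n⌋ for u the maximum of g over 0 ≤ c ≤ n.
      g : ℕ → ℕ
      g c = n * P c ∸ c * k

      module AtMaximum {c* : ℕ} (c*≤n : c* ≤ n) (maximal : ∀ {c} → c ≤ n → g c ≤ g c*) where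
        open ≤-Reasoning

        u = g c*

        lower : ∀ {c} → c ≤ n → n * P c ≤ c * k + u
        lower {c} c≤n = ≤-trans (m≤n+m∸n (n * P c) (c * k)) (+-monoʳ-≤ (c * k) (maximal c≤n))

        upper : ∀ {c} → c ≤ n → c * k + u ≤ n * P c + q * k
        upper {c} c≤n with ≤-total (c* * k) (n * P c*)
        ... | inj₁ c*k≤nP = +-cancelʳ-≤ (c* * k) _ _ (begin
          c * k + u + c* * k        ≡⟨ +-assoc (c * k) u (c* * k) ⟩
          c * k + (u + c* * k)      ≡⟨ cong (c * k +_) (m∸n+n≡m c*k≤nP) ⟩
          c * k + n * P c*          ≡⟨ +-comm (c * k) (n * P c*) ⟩
          n * P c* + c * k          ≤⟨ balanced c*≤n c≤n ⟩
          n * P c + c* * k + q * k  ≡⟨ xy∙z≈xz∙y (n * P c) (c* * k) (q * k) ⟩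
          n * P c + q * k + c* * k  ∎)
        ... | inj₂ nP≤c*k = begin
          c * k + u            ≡⟨ cong (c * k +_) (m≤n⇒m∸n≡0 nP≤c*k) ⟩
          c * k + 0            ≡⟨ +-identityʳ (c * k) ⟩
          c * k                ≡⟨ cong (_+ c * k) (*-zeroʳ n) ⟨
          n * 0 + c * k        ≤⟨ balanced z≤n c≤n ⟩
          n * P c + 0 + q * k  ≡⟨ cong (_+ q * k) (+-identityʳ (n * P c)) ⟩
          n * P c + q * k      ∎

        u<n : u < n
        u<n = s≤s (+-cancelˡ-≤ (n * k) u (q * k) (begin
          n * k + u        ≤⟨ upper ≤-refl ⟩
          n * P n + q * k  ≡⟨ cong (λ p → n * p + q * k) Pn≡k ⟩
          n * k + q * k    ∎))

        P≡level : ∀ {c} → c ≤ n → P c ≡ level u c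
        P≡level {c} c≤n = sym (quotient-unique n (P c) (c * k + u)
          (subst (_≤ c * k + u) (*-comm n (P c)) (lower c≤n))
          (begin-strict
            c * k + u        ≤⟨ upper c≤n ⟩
            n * P c + q * k  <⟨ +-monoʳ-< (n * P c) qk<n ⟩
            n * P c + n      ≡⟨ cong (_+ n) (*-comm n (P c)) ⟩
            P c * n + n      ∎))

    balanced⇒mechanical : ∃ λ u → u < n × I ≡ mechanical u
    balanced⇒mechanical = from-maximum (bounded-argmax g n)
      where
      from-maximum : (∃ λ c* → c* ≤ n × ∀ {c} → c ≤ n → g c ≤ g c*) → ∃ λ u → u < n × I ≡ mechanical u
      from-maximum (c* , c*≤n , maximal) = u , u<n , count-injective I (mechanical u) λ c c≤n →
        trans (P≡level c≤n) (sym (count-mechanical u<n c≤n))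
        where open AtMaximum c*≤n maximal

  private
    a≢n+a : ∀ {a} → a ≢ n + a
    a≢n+a = <⇒≢ (m<n+m _ z<s)

  module _ {G : ℕ → ℕ} (G0≡0 : G 0 ≡ 0) (Gn≡k : G n ≡ k) where
    private
      c+n≤n⇒c≡0 : ∀ {c} → c + n ≤ n → c ≡ 0
      c+n≤n⇒c≡0 {c} c+n≤n = n≤0⇒n≡0 (+-cancelʳ-≤ n c 0 c+n≤n)

      forward : ∀ {c d} → c + d ≤ n → n * G c + d * k ≢ n * suc (G (c + d))
      forward {c} {d} c+d≤n E
        with n∣d*k⇒d≡0∨d≡n (∣m+n∣m⇒∣n (divides (suc (G (c + d))) (trans E (*-comm n (suc (G (c + d)))))) (m∣m*n (G c)))
                            (m+n≤o⇒n≤o c c+d≤n)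
      ... | inj₁ refl = a≢n+a (begin
        n * G c              ≡⟨ +-identityʳ (n * G c) ⟨
        n * G c + 0          ≡⟨ E ⟩
        n * suc (G (c + 0))  ≡⟨ cong (λ x → n * suc (G x)) (+-identityʳ c) ⟩
        n * suc (G c)        ≡⟨ *-suc n (G c) ⟩
        n + n * G c          ∎)
        where open ≡-Reasoning
      ... | inj₂ refl with refl ← c+n≤n⇒c≡0 c+d≤n = a≢n+a (begin
        n * k            ≡⟨ cong (_+ n * k) (*-zeroʳ n) ⟨
        n * 0 + n * k    ≡⟨ cong (λ g → n * g + n * k) G0≡0 ⟨
        n * G 0 + n * k  ≡⟨ E ⟩
        n * suc (G n)    ≡⟨ cong (λ g → n * suc g) Gn≡k ⟩
        n * suc k        ≡⟨ *-suc n k ⟩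
        n + n * k        ∎)
        where open ≡-Reasoning

      backward : ∀ {c d} → c + d ≤ n → n * G (c + d) ≢ n * suc (G c) + d * k
      backward {c} {d} c+d≤n E
        with n∣d*k⇒d≡0∨d≡n (∣m+n∣m⇒∣n (divides (G (c + d)) (trans (sym E) (*-comm n (G (c + d))))) (m∣m*n (suc (G c))))
                            (m+n≤o⇒n≤o c c+d≤n)
      ... | inj₁ refl = a≢n+a (begin
        n * G c            ≡⟨ cong (λ x → n * G x) (+-identityʳ c) ⟨
        n * G (c + 0)      ≡⟨ E ⟩
        n * suc (G c) + 0  ≡⟨ +-identityʳ (n * suc (G c)) ⟩
        n * suc (G c)      ≡⟨ *-suc n (G c) ⟩
        n + n * G c        ∎)
        where open ≡-Reasoning
      ... | inj₂ refl with refl ← c+n≤n⇒c≡0 c+d≤n = a≢n+a (begin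
        n * k                  ≡⟨ cong (n *_) Gn≡k ⟨
        n * G n                ≡⟨ E ⟩
        n * suc (G 0) + n * k  ≡⟨ cong (λ g → n * suc g + n * k) G0≡0 ⟩
        n * 1 + n * k          ≡⟨ cong (_+ n * k) (*-identityʳ n) ⟩
        n + n * k              ∎)
        where open ≡-Reasoning

      regroup₁ : ∀ a d c k → a + d * k + c * k ≡ a + (c + d) * k
      regroup₁ = solve-∀
      regroup₂ : ∀ n g c k → n * g + c * k + n ≡ n * (1 + g) + c * k
      regroup₂ = solve-∀
      regroup₃ : ∀ n g c d k → n * g + (c + d) * k + n ≡ n * (1 + g) + d * k + c * k
      regroup₃ = solve-∀

    -- Such an equation gives n ∣ (c₂ − c₁) k, so c₂ − c₁ ∈ {0, ±n} as n and k are coprime.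
    no-gap-of-n : ∀ {c₁ c₂} → c₁ ≤ n → c₂ ≤ n → n * G c₁ + c₂ * k ≢ n * G c₂ + c₁ * k + n
    no-gap-of-n {c₁} {c₂} c₁≤n c₂≤n eq with ≤-total c₁ c₂
    ... | inj₁ c₁≤c₂ with d , refl ← m≤n⇒∃[o]m+o≡n c₁≤c₂ =
      forward c₂≤n (+-cancelʳ-≡ (c₁ * k) _ _
        (trans (regroup₁ (n * G c₁) d c₁ k) (trans eq (regroup₂ n (G (c₁ + d)) c₁ k))))
    ... | inj₂ c₂≤c₁ with d , refl ← m≤n⇒∃[o]m+o≡n c₂≤c₁ =
      backward c₁≤n (+-cancelʳ-≡ (c₂ * k) _ _ (trans eq (regroup₃ n (G c₂) c₂ d k)))

  module _ {u c : ℕ} where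

    ≤level⇒ : ∀ {g} → g ≤ level u c → n * g ≤ c * k + u
    ≤level⇒ {g} g≤level = subst (_≤ c * k + u) (*-comm g n) (≤/⇒*≤ n (c * k + u) g≤level)

    level≤⇒ : ∀ {g} → level u c ≤ g → c * k + u < n * g + n
    level≤⇒ {g} level≤g = subst (c * k + u <_) (trans (+-comm n (g * n)) (cong (_+ n) (*-comm g n)))
      (/<⇒<* n (c * k + u) (s≤s level≤g))

    ≤1+level⇒ : ∀ {g} → g ≤ suc (level u c) → n * g ≤ c * k + u + n
    ≤1+level⇒ {g} g≤1+level = begin
      n * g                ≤⟨ *-monoʳ-≤ n g≤1+level ⟩
      n * suc (level u c)  ≡⟨ *-suc n (level u c) ⟩
      n + n * level u c    ≡⟨ +-comm n (n * level u c) ⟩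
      n * level u c + n    ≤⟨ +-monoˡ-≤ n (subst (_≤ c * k + u) (*-comm (level u c) n) (m/n*n≤m (c * k + u) n)) ⟩
      c * k + u + n        ∎
      where open ≤-Reasoning

    level≤1+⇒ : ∀ {g} → level u c ≤ suc g → c * k + u < n * g + n + n
    level≤1+⇒ {g} level≤1+g =
      subst (c * k + u <_) (cong (_+ n) (trans (*-suc n g) (+-comm n (n * g)))) (level≤⇒ level≤1+g)

  private
    ≤+n∧≢⇒≤+qk : ∀ {a b} → a ≤ b + n → a ≢ b + n → a ≤ b + q * k
    ≤+n∧≢⇒≤+qk {a} {b} a≤b+n a≢b+n = s≤s⁻¹ (subst (a <_) (+-suc b (q * k)) (≤∧≢⇒< a≤b+n a≢b+n))

  module _ {J : Subset n} (Gn≡k : count J n ≡ k)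
           (comparable : ∀ {u} → u < n → Leads 0 (mechanical u) J ⊎ Leads 0 J (mechanical u)) where
    private
      G = count J

      no-gap : ∀ {c₁ c₂} → c₁ ≤ n → c₂ ≤ n → n * G c₁ + c₂ * k ≢ n * G c₂ + c₁ * k + n
      no-gap = no-gap-of-n {G} refl Gn≡k

      module _ {u c : ℕ} (u<n : u < n) (c≤n : c ≤ n) where
        mechanical-leads⇒ : Leads 0 (mechanical u) J → n * G c ≤ c * k + u × c * k + u < n * G c + n + n
        mechanical-leads⇒ leads =
          ≤level⇒ {u} {c} (subst (G c ≤_) count≡level lo) , level≤1+⇒ {u} {c} (subst (_≤ suc (G c)) count≡level hi)
          where
          count≡level = count-mechanical u<n c≤n
          lo = proj₁ (leads c)
          hi = proj₂ (leads c)

        leads-mechanical⇒ : Leads 0 J (mechanical u) → c * k + u < n * G c + n × n * G c ≤ c * k + u + n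
        leads-mechanical⇒ leads =
          level≤⇒ {u} {c} (subst (_≤ G c) count≡level lo) , ≤1+level⇒ {u} {c} (subst (λ x → G c ≤ suc x) count≡level hi)
          where
          count≡level = count-mechanical u<n c≤n
          lo = proj₁ (leads c)
          hi = proj₂ (leads c)

      -- The cases c₂ ≡ 0 and c₁ ≡ 0 of balancedness, by comparison with W 0 and W (q k).
      upper : ∀ {c} → c ≤ n → n * G c ≤ c * k + q * k
      upper {c} c≤n with comparable {0} z<s
      ... | inj₁ leads = ≤-trans (proj₁ (mechanical-leads⇒ z<s c≤n leads)) (+-monoʳ-≤ (c * k) z≤n)
      ... | inj₂ leads = subst (λ x → n * G c ≤ x + q * k) (+-identityʳ (c * k))
        (≤+n∧≢⇒≤+qk (proj₂ (leads-mechanical⇒ z<s c≤n leads)) λ eq →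
          no-gap c≤n z≤n (trans (+-identityʳ (n * G c))
            (trans eq (cong (_+ n) (trans (+-identityʳ (c * k)) (cong (_+ c * k) (sym (*-zeroʳ n))))))))

      lower : ∀ {c} → c ≤ n → c * k ≤ n * G c + q * k
      lower {c} c≤n with comparable qk<n
      ... | inj₂ leads = ≤-trans (+-cancelʳ-≤ (q * k) (c * k) (n * G c)
              (s≤s⁻¹ (subst (c * k + q * k <_) (+-suc (n * G c) (q * k)) (proj₁ (leads-mechanical⇒ qk<n c≤n leads)))))
            (m≤m+n (n * G c) (q * k))
      ... | inj₁ leads = ≤+n∧≢⇒≤+qk
              (+-cancelʳ-≤ (q * k) (c * k) (n * G c + n)
                (s≤s⁻¹ (subst (c * k + q * k <_) (+-suc (n * G c + n) (q * k)) (proj₂ (mechanical-leads⇒ qk<n c≤n leads)))))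
              λ eq → no-gap z≤n c≤n (trans (cong (_+ c * k) (*-zeroʳ n))
                        (trans eq (cong (_+ n) (sym (+-identityʳ (n * G c))))))

      -- Otherwise J could be compared with W (n G c₁ − c₁ k − 1) in neither direction.
      no-imbalance : ∀ {c₁ c₂} → c₁ ≤ n → c₂ ≤ n → ¬ (n * G c₂ + c₁ * k + n ≤ n * G c₁ + c₂ * k)
      no-imbalance {c₁} {c₂} c₁≤n c₂≤n imbalance = at (m∸n+n≡m 1+c₁k≤nGc₁) u<n (comparable u<n)
        where
        open ≤-Reasoning
        regroup₁ : ∀ a c m → a + (1 + c + m) ≡ a + c + (1 + m)
        regroup₁ = solve-∀
        regroup₂ : ∀ u a b → u + (1 + a) + b ≡ 1 + (b + u) + a
        regroup₂ = solve-∀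

        1+c₁k≤nGc₁ : suc (c₁ * k) ≤ n * G c₁
        1+c₁k≤nGc₁ = +-cancelʳ-≤ (q * k) _ _ (+-cancelˡ-≤ (n * G c₂) _ _ (begin
          n * G c₂ + (suc (c₁ * k) + q * k)  ≡⟨ regroup₁ (n * G c₂) (c₁ * k) (q * k) ⟩
          n * G c₂ + c₁ * k + n              ≤⟨ imbalance ⟩
          n * G c₁ + c₂ * k                  ≤⟨ +-monoʳ-≤ (n * G c₁) (lower c₂≤n) ⟩
          n * G c₁ + (n * G c₂ + q * k)      ≡⟨ x∙yz≈y∙xz (n * G c₁) (n * G c₂) (q * k) ⟩
          n * G c₂ + (n * G c₁ + q * k)      ∎))

        u = n * G c₁ ∸ suc (c₁ * k)

        u<n : u < n
        u<n = s≤s (≤-trans (n≤1+n u) (+-cancelʳ-≤ (c₁ * k) (suc u) (q * k) (begin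
          suc u + c₁ * k    ≡⟨ +-suc u (c₁ * k) ⟨
          u + suc (c₁ * k)  ≡⟨ m∸n+n≡m 1+c₁k≤nGc₁ ⟩
          n * G c₁          ≤⟨ upper c₁≤n ⟩
          c₁ * k + q * k    ≡⟨ +-comm (c₁ * k) (q * k) ⟩
          q * k + c₁ * k    ∎)))

        at : ∀ {u} → u + suc (c₁ * k) ≡ n * G c₁ → (u<n : u < n) →
          Leads 0 (mechanical u) J ⊎ Leads 0 J (mechanical u) → ⊥
        at {u} u+1+c₁k≡nGc₁ u<n (inj₁ leads) =
          <⇒≱ (≤-reflexive (trans (cong suc (+-comm (c₁ * k) u)) (trans (sym (+-suc u (c₁ * k))) u+1+c₁k≡nGc₁)))
              (proj₁ (mechanical-leads⇒ u<n c₁≤n leads))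
        at {u} u+1+c₁k≡nGc₁ u<n (inj₂ leads) = no-gap c₁≤n c₂≤n (≤-antisym (begin
          n * G c₁ + c₂ * k          ≡⟨ cong (_+ c₂ * k) u+1+c₁k≡nGc₁ ⟨
          u + suc (c₁ * k) + c₂ * k  ≡⟨ regroup₂ u (c₁ * k) (c₂ * k) ⟩
          suc (c₂ * k + u) + c₁ * k  ≤⟨ +-monoˡ-≤ (c₁ * k) (proj₁ (leads-mechanical⇒ u<n c₂≤n leads)) ⟩
          n * G c₂ + n + c₁ * k      ≡⟨ xy∙z≈xz∙y (n * G c₂) n (c₁ * k) ⟩
          n * G c₂ + c₁ * k + n               ∎) imbalance)

    comparable⇒balanced : Balanced (count J)
    comparable⇒balanced {c₁} {c₂} c₁≤n c₂≤n = ≮⇒≥ λ lt →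
      no-imbalance c₁≤n c₂≤n (subst (_≤ n * G c₁ + c₂ * k) (sym (+-suc (n * G c₂ + c₁ * k) (q * k))) lt)

  intercept : Fin n → ℕ
  intercept t = q * k ∸ toℕ t

  intercept<n : ∀ t → intercept t < n
  intercept<n t = s≤s (m∸n≤m (q * k) (toℕ t))

  vertex : Fin n → Subset n
  vertex t = mechanical (intercept t)

  module _ (t : Fin n) {c α b : ℕ} (ck≡αn+b : c * k ≡ α * n + b) (b≤n : b ≤ n) where
    private
      u = intercept t

      u+t≡qk : u + toℕ t ≡ q * k
      u+t≡qk = m∸n+n≡m (s≤s⁻¹ (Finₚ.toℕ<n t))

      ck+u≡ : c * k + u ≡ α * n + (b + u)
      ck+u≡ = trans (cong (_+ u) ck≡αn+b) (+-assoc (α * n) b u)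

      regroup : ∀ a n → a * n + (n + n) ≡ (1 + a) * n + n
      regroup = solve-∀

    level-intercept : level (intercept t) c ≡ α + bit (toℕ t <ᵇ b)
    level-intercept with toℕ t <? b
    ... | yes t<b =
      trans (quotient-unique n (suc α) (c * k + u) lo hi) (trans (+-comm 1 α) (cong (α +_) (sym (bit-< t<b))))
      where
      open ≤-Reasoning
      lo : suc α * n ≤ c * k + u
      lo = begin
        suc α * n                  ≡⟨ +-comm n (α * n) ⟩
        α * n + suc (q * k)        ≡⟨ cong (λ x → α * n + suc x) (trans (sym u+t≡qk) (+-comm u (toℕ t))) ⟩
        α * n + (suc (toℕ t) + u)  ≤⟨ +-monoʳ-≤ (α * n) (+-monoˡ-≤ u t<b) ⟩
        α * n + (b + u)            ≡⟨ ck+u≡ ⟨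
        c * k + u                  ∎
      hi : c * k + u < suc α * n + n
      hi = begin-strict
        c * k + u        ≡⟨ ck+u≡ ⟩
        α * n + (b + u)  <⟨ +-monoʳ-< (α * n) (+-mono-≤-< b≤n (intercept<n t)) ⟩
        α * n + (n + n)  ≡⟨ regroup α n ⟩
        suc α * n + n    ∎
    ... | no t≮b =
      trans (quotient-unique n α (c * k + u) lo hi) (sym (trans (cong (α +_) (bit-≥ (≮⇒≥ t≮b))) (+-identityʳ α)))
      where
      open ≤-Reasoning
      lo : α * n ≤ c * k + u
      lo = subst (α * n ≤_) (sym ck+u≡) (m≤m+n (α * n) (b + u))
      hi : c * k + u < α * n + n
      hi = begin-strict
        c * k + u            ≡⟨ ck+u≡ ⟩
        α * n + (b + u)      ≤⟨ +-monoʳ-≤ (α * n) (+-monoˡ-≤ u (≮⇒≥ t≮b)) ⟩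
        α * n + (toℕ t + u)  ≡⟨ cong (α * n +_) (trans (+-comm (toℕ t) u) u+t≡qk) ⟩
        α * n + q * k        <⟨ +-monoʳ-< (α * n) qk<n ⟩
        α * n + n            ∎

  residue-hit : ∀ {b} → b ≤ n → ∃ λ c → ∃ λ α → c ≤ n × c * k ≡ α * n + b
  residue-hit {b} b≤n with b % k | m≡m%n+[m/n]*n b k | m%n<n b k
  ... | zero | b≡sk | _ = b / k , 0 , ≤-trans (m≤m*n (b / k) k) (subst (_≤ n) b≡sk b≤n) , sym b≡sk
  ... | suc r | b≡1+r+sk | 1+r<k = c , w , c≤n , ck≡wn+b
    where
    open ≤-Reasoning
    s = b / k
    w = k ∸ suc r
    w+1+r≡k : w + suc r ≡ k
    w+1+r≡k = m∸n+n≡m (<⇒≤ 1+r<k)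
    c = w * q + suc s
    expand : ∀ w q s k → (w * q + (1 + s)) * k ≡ w * (q * k) + k + s * k
    expand = solve-∀
    regroup : ∀ w x r s k → w * x + (w + (1 + r)) + s * k ≡ w * (1 + x) + ((1 + r) + s * k)
    regroup = solve-∀
    ck≡wn+b : c * k ≡ w * n + b
    ck≡wn+b = begin-equality
      c * k                              ≡⟨ expand w q s k ⟩
      w * (q * k) + k + s * k            ≡⟨ cong (λ x → w * (q * k) + x + s * k) w+1+r≡k ⟨
      w * (q * k) + (w + suc r) + s * k  ≡⟨ regroup w (q * k) r s k ⟩
      w * n + (suc r + s * k)            ≡⟨ cong (w * n +_) b≡1+r+sk ⟨
      w * n + b                          ∎
    s≤q : s ≤ q
    s≤q = *-cancelʳ-≤ s q k (s≤s⁻¹ (≤-trans (s≤s (m≤n+m (s * k) r)) (subst (_≤ n) b≡1+r+sk b≤n)))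
    1+w≤k : suc w ≤ k
    1+w≤k = subst (suc w ≤_) w+1+r≡k (subst (suc w ≤_) (sym (+-suc w r)) (s≤s (m≤m+n w r)))
    c≤n : c ≤ n
    c≤n = begin
      w * q + suc s    ≡⟨ +-suc (w * q) s ⟩
      suc (w * q + s)  ≤⟨ s≤s (+-monoʳ-≤ (w * q) s≤q) ⟩
      suc (w * q + q)  ≡⟨ cong suc (+-comm (w * q) q) ⟩
      suc (suc w * q)  ≤⟨ s≤s (*-monoˡ-≤ q 1+w≤k) ⟩
      suc (k * q)      ≡⟨ cong suc (*-comm k q) ⟩
      n                ∎

  module _ (λ′ : Fin n → ℚ) where

    rowSum : Fin n → ℚ
    rowSum c = sum λ a → λ′ a ℚ.* χ (vertex a) c

    weightedCount : ℕ → ℚ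
    weightedCount c = sum λ a → λ′ a ℚ.* fromℤ (ℤ.+ count (vertex a) c)

    weightedCount-step : ∀ i → weightedCount (suc (toℕ i)) ≡ weightedCount (toℕ i) ℚ.+ rowSum i
    weightedCount-step i = begin
      weightedCount (suc (toℕ i))
        ≡⟨ sum-cong-≗ (λ a → cong (λ m → λ′ a ℚ.* fromℤ (ℤ.+ m)) (count-suc-toℕ (vertex a) i)) ⟩
      sum (λ a → λ′ a ℚ.* fromℤ (ℤ.+ (bit (lookup (vertex a) i) + count (vertex a) (toℕ i))))
        ≡⟨ sum-cong-≗ (λ a → *-fromℤ-+ (λ′ a) (bit (lookup (vertex a) i)) (count (vertex a) (toℕ i))) ⟩
      sum (λ a → new a ℚ.+ old a)
        ≡⟨ ∑-distrib-+ new old ⟩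
      sum new ℚ.+ weightedCount (toℕ i)
        ≡⟨ cong (ℚ._+ weightedCount (toℕ i)) (sum-cong-≗ λ a → cong (λ′ a ℚ.*_) (sym (χ≡fromℤ-bit (vertex a) i))) ⟩
      rowSum i ℚ.+ weightedCount (toℕ i)
        ≡⟨ ℚₚ.+-comm (rowSum i) (weightedCount (toℕ i)) ⟩
      weightedCount (toℕ i) ℚ.+ rowSum i ∎
      where
      open ≡-Reasoning
      new old : Fin n → ℚ
      new a = λ′ a ℚ.* fromℤ (ℤ.+ bit (lookup (vertex a) i))
      old a = λ′ a ℚ.* fromℤ (ℤ.+ count (vertex a) (toℕ i))

    weightedCount≡prefixSum : ∀ {g} → (∀ i → rowSum i ≡ g i) → ∀ {c} → c ≤ n → weightedCount c ≡ prefixSum g c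
    weightedCount≡prefixSum {g} rowSum≡g = prefixSum-unique weightedCount g
      (trans (sum-cong-≗ (ℚₚ.*-zeroʳ ∘ λ′)) (sum-replicate-zero n))
      (λ i → trans (weightedCount-step i) (cong (weightedCount (toℕ i) ℚ.+_) (rowSum≡g i)))

    weightedCount-residue : ∀ {c α b} → c ≤ n → c * k ≡ α * n + b → b ≤ n →
      weightedCount c ≡ fromℤ (ℤ.+ α) ℚ.* sum λ′ ℚ.+ prefixSum λ′ b
    weightedCount-residue {c} {α} {b} c≤n ck≡αn+b b≤n = begin
      weightedCount c
        ≡⟨ sum-cong-≗ (λ a → cong (λ m → λ′ a ℚ.* fromℤ (ℤ.+ m))
             (trans (count-mechanical (intercept<n a) c≤n) (level-intercept a {c} {α} {b} ck≡αn+b b≤n))) ⟩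
      sum (λ a → λ′ a ℚ.* fromℤ (ℤ.+ (α + bit (toℕ a <ᵇ b))))
        ≡⟨ sum-cong-≗ (λ a → trans (*-fromℤ-+ (λ′ a) α (bit (toℕ a <ᵇ b)))
                                    (cong (ℚ._+ below a) (ℚₚ.*-comm (λ′ a) A))) ⟩
      sum (λ a → A ℚ.* λ′ a ℚ.+ below a)
        ≡⟨ ∑-distrib-+ (λ a → A ℚ.* λ′ a) below ⟩
      sum (λ a → A ℚ.* λ′ a) ℚ.+ sum below
        ≡⟨ cong₂ ℚ._+_ (*-distribˡ-sum A λ′) (sym (prefixSum-indicator λ′ b)) ⟨
      A ℚ.* sum λ′ ℚ.+ prefixSum λ′ b ∎
      where
      open ≡-Reasoning
      A = fromℤ (ℤ.+ α)
      below : Fin n → ℚ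
      below a = λ′ a ℚ.* fromℤ (ℤ.+ bit (toℕ a <ᵇ b))

    prefix-weights : ∀ {g} → (∀ i → rowSum i ≡ g i) → ∀ {b} → b ≤ n →
      ∃ λ c → ∃ λ α → prefixSum λ′ b ≡ prefixSum g c ℚ.- fromℤ (ℤ.+ α) ℚ.* sum λ′
    prefix-weights {g} rowSum≡g {b} b≤n = from-residue (residue-hit b≤n)
      where
      from-residue : (∃ λ c → ∃ λ α → c ≤ n × c * k ≡ α * n + b) →
        ∃ λ c → ∃ λ α → prefixSum λ′ b ≡ prefixSum g c ℚ.- fromℤ (ℤ.+ α) ℚ.* sum λ′
      from-residue (c , α , c≤n , ck≡αn+b) = c , α , (begin
        prefixSum λ′ b              ≡⟨ solve 2 (λ x y → y := x :+ y :- x) refl A (prefixSum λ′ b) ⟩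
        A ℚ.+ prefixSum λ′ b ℚ.- A  ≡⟨ cong (ℚ._- A) (weightedCount-residue c≤n ck≡αn+b b≤n) ⟨
        weightedCount c ℚ.- A       ≡⟨ cong (ℚ._- A) (weightedCount≡prefixSum rowSum≡g c≤n) ⟩
        prefixSum g c ℚ.- A         ∎)
        where
        open ≡-Reasoning
        open +-*-Solver
        A = fromℤ (ℤ.+ α) ℚ.* sum λ′

  vertex-affIndep : AffIndep (χ ∘ vertex)
  vertex-affIndep λ′ Σλ′≡0 rows≡0 a = begin
    λ′ a
      ≡⟨ f≡Δ-prefixSum λ′ a ⟩
    prefixSum λ′ (suc (toℕ a)) ℚ.- prefixSum λ′ (toℕ a)
      ≡⟨ cong₂ ℚ._-_ (prefix≡0 (Finₚ.toℕ<n a)) (prefix≡0 (<⇒≤ (Finₚ.toℕ<n a))) ⟩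
    0ℚ ℚ.- 0ℚ
      ≡⟨⟩
    0ℚ ∎
    where
    open ≡-Reasoning
    prefix≡0 : ∀ {b} → b ≤ n → prefixSum λ′ b ≡ 0ℚ
    prefix≡0 {b} b≤n = from-weights (prefix-weights λ′ rows≡0′ b≤n)
      where
      rows≡0′ : ∀ i → rowSum λ′ i ≡ 0ℚ
      rows≡0′ i = trans (sym (Σℚ≡sum (λ a → λ′ a ℚ.* χ (vertex a) i))) (rows≡0 i)
      from-weights :
        (∃ λ c → ∃ λ α → prefixSum λ′ b ≡ prefixSum {n} (λ _ → 0ℚ) c ℚ.- fromℤ (ℤ.+ α) ℚ.* sum λ′) →
        prefixSum λ′ b ≡ 0ℚ
      from-weights (c , α , prefix≡) = begin
        prefixSum λ′ b
          ≡⟨ prefix≡ ⟩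
        prefixSum (λ _ → 0ℚ) c ℚ.- fromℤ (ℤ.+ α) ℚ.* sum λ′
          ≡⟨ cong₂ (λ x y → x ℚ.- fromℤ (ℤ.+ α) ℚ.* y) (prefixSum-zero {n} c) (trans (sym (Σℚ≡sum λ′)) Σλ′≡0) ⟩
        0ℚ ℚ.- fromℤ (ℤ.+ α) ℚ.* 0ℚ
          ≡⟨ cong (λ x → 0ℚ ℚ.- x) (ℚₚ.*-zeroʳ (fromℤ (ℤ.+ α))) ⟩
        0ℚ ∎

  vertex-unimodular : Unimodular vertex
  vertex-unimodular = vertex-affIndep , integral-coefficients
    where
    integral-coefficients : (z : Fin n → ℤ) (μ : Fin n → ℚ) → Σℚ μ ≡ 1ℚ →
      (∀ c → Σℚ (λ a → μ a ℚ.* χ (vertex a) c) ≡ z c ℚ./ 1) →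
      Σ (Fin n → ℤ) λ ν → Σℤ ν ≡ ℤ.+ 1 × (∀ c → Σℤ (λ a → ν a ℤ.* χℤ (vertex a) c) ≡ z c)
    integral-coefficients z μ Σμ≡1 rows≡z = ν , Σν≡1 , rows-ν
      where
      rows : ∀ i → rowSum μ i ≡ fromℤ (z i)
      rows i = trans (sym (Σℚ≡sum (λ a → μ a ℚ.* χ (vertex a) i))) (trans (rows≡z i) (z/1≡fromℤ (z i)))

      integral-prefix : ∀ {b} → b ≤ n → Integral (prefixSum μ b)
      integral-prefix {b} b≤n = from-weights (prefix-weights μ rows b≤n)
        where
        from-weights :
          (∃ λ c → ∃ λ α → prefixSum μ b ≡ prefixSum (fromℤ ∘ z) c ℚ.- fromℤ (ℤ.+ α) ℚ.* sum μ) →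
          Integral (prefixSum μ b)
        from-weights (c , α , prefix≡) =
          subst Integral (sym (trans prefix≡ (cong (λ x → prefixSum (fromℤ ∘ z) c ℚ.- x) α*Σμ≡α)))
          (integral-- (integral-prefixSum z c) (ℤ.+ α , refl))
          where
          α*Σμ≡α : fromℤ (ℤ.+ α) ℚ.* sum μ ≡ fromℤ (ℤ.+ α)
          α*Σμ≡α = trans (cong (fromℤ (ℤ.+ α) ℚ.*_) (trans (sym (Σℚ≡sum μ)) Σμ≡1)) (ℚₚ.*-identityʳ _)

      integral-μ : ∀ a → Integral (μ a)
      integral-μ a = subst Integral (sym (f≡Δ-prefixSum μ a))
        (integral-- (integral-prefix (Finₚ.toℕ<n a)) (integral-prefix (<⇒≤ (Finₚ.toℕ<n a))))

      ν : Fin n → ℤ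
      ν a = proj₁ (integral-μ a)

      fromℤ∘ν≡μ : ∀ a → fromℤ (ν a) ≡ μ a
      fromℤ∘ν≡μ a = proj₂ (integral-μ a)

      Σν≡1 : Σℤ ν ≡ ℤ.+ 1
      Σν≡1 = fromℤ-injective (begin
        fromℤ (Σℤ ν)     ≡⟨ fromℤ-Σ ν ⟩
        sum (fromℤ ∘ ν)  ≡⟨ sum-cong-≗ fromℤ∘ν≡μ ⟩
        sum μ            ≡⟨ Σℚ≡sum μ ⟨
        Σℚ μ             ≡⟨ Σμ≡1 ⟩
        1ℚ               ∎)
        where open ≡-Reasoning

      rows-ν : ∀ c → Σℤ (λ a → ν a ℤ.* χℤ (vertex a) c) ≡ z c
      rows-ν c = fromℤ-injective (begin
        fromℤ (Σℤ (λ a → ν a ℤ.* χℤ (vertex a) c))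
          ≡⟨ fromℤ-Σ (λ a → ν a ℤ.* χℤ (vertex a) c) ⟩
        sum (λ a → fromℤ (ν a ℤ.* χℤ (vertex a) c))
          ≡⟨ sum-cong-≗ (λ a → trans (fromℤ-* (ν a) (χℤ (vertex a) c))
                                       (cong₂ ℚ._*_ (fromℤ∘ν≡μ a) (fromℤ-χℤ (vertex a) c))) ⟩
        rowSum μ c
          ≡⟨ rows c ⟩
        fromℤ (z c) ∎)
        where open ≡-Reasoning

  intercept-surjective : ∀ {u} → u < n → ∃ λ t → intercept t ≡ u
  intercept-surjective {u} u<n =
    fromℕ< qk∸u<n , trans (cong (q * k ∸_) (Finₚ.toℕ-fromℕ< qk∸u<n)) (m∸[m∸n]≡n (s≤s⁻¹ u<n))
    where
    qk∸u<n : q * k ∸ u < n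
    qk∸u<n = s≤s (m∸n≤m (q * k) u)

  mechanical⇒vertex : ∀ {I} → (∃ λ u → u < n × I ≡ mechanical u) → ∃ λ t → vertex t ≡ I
  mechanical⇒vertex (u , u<n , refl) = map₂ (cong mechanical) (intercept-surjective u<n)

  vertex-stable : ∀ {r} t → r ≤ n / k → StableKSubset k r (vertex t)
  vertex-stable t = mechanical-stableKSubset (intercept<n t)

  q≤n/k : q ≤ n / k
  q≤n/k = subst (_≤ n / k) (m*n/n≡m q k) (/-monoˡ-≤ k (n≤1+n (q * k)))

  stable⇒vertex : ∀ I → StableKSubset k (n / k) I → ∃ λ t → vertex t ≡ I
  stable⇒vertex I (∣I∣≡k , stable) = mechanical⇒vertex
    (balanced⇒mechanical (stable⇒balanced (λ i j i∈ j∈ i≢j → ≤-trans q≤n/k (stable i j i∈ j∈ i≢j)) ∣I∣≡k)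
                         (trans (sym (∣v∣≡count I)) ∣I∣≡k))

  vertex-separated : ∀ {a b} → toℕ a < toℕ b → vertex a ≢ vertex b
  vertex-separated {a} {b} a<b va≡vb = from-residue (residue-hit (<⇒≤ (Finₚ.toℕ<n b)))
    where
    from-residue : (∃ λ c → ∃ λ α → c ≤ n × c * k ≡ α * n + toℕ b) → ⊥
    from-residue (c , α , c≤n , ck≡αn+b) = 1≢0 (+-cancelˡ-≡ α 1 0 (begin
      α + 1                     ≡⟨ cong (α +_) (bit-< a<b) ⟨
      α + bit (toℕ a <ᵇ toℕ b)  ≡⟨ level-intercept a {c} {α} ck≡αn+b (<⇒≤ (Finₚ.toℕ<n b)) ⟨
      level (intercept a) c     ≡⟨ count-mechanical (intercept<n a) c≤n ⟨
      count (vertex a) c        ≡⟨ cong (λ I → count I c) va≡vb ⟩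
      count (vertex b) c        ≡⟨ count-mechanical (intercept<n b) c≤n ⟩
      level (intercept b) c     ≡⟨ level-intercept b {c} {α} ck≡αn+b (<⇒≤ (Finₚ.toℕ<n b)) ⟩
      α + bit (toℕ b <ᵇ toℕ b)  ≡⟨ cong (α +_) (bit-≥ (≤-refl {toℕ b})) ⟩
      α + 0                     ∎))
      where
      open ≡-Reasoning
      1≢0 : 1 ≢ 0
      1≢0 ()

  vertex-injective : Injective _≡_ _≡_ vertex
  vertex-injective {a} {b} va≡vb with <-cmp (toℕ a) (toℕ b)
  ... | tri< a<b _ _ = ⊥-elim (vertex-separated a<b va≡vb)
  ... | tri≈ _ a≡b _ = Finₚ.toℕ-injective a≡b
  ... | tri> _ _ b<a = ⊥-elim (vertex-separated b<a (sym va≡vb))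

  vertex-sorted : ∀ a b → a Fin.< b → SortedPair (vertex a) (vertex b)
  vertex-sorted a b a<b = Equivalence.from (sortedPair⇔leads (vertex a) (vertex b))
    (mechanical-leads (∸-monoʳ-≤ (q * k) (<⇒≤ a<b)) (intercept<n a))

  stable-circuitSimplex : IsCircuitSimplex k (StableKSubset {n} k (n / k))
  stable-circuitSimplex =
    n , vertex , ((λ a → ∣mechanical∣ (intercept<n a)) , vertex-sorted) , (λ a → vertex-stable a ≤-refl) , stable⇒vertex

  stable-maxCircuitSimplex : IsMaxCircuitSimplex k (StableKSubset {n} k (n / k))
  stable-maxCircuitSimplex = stable-circuitSimplex , maximal
    where
    maximal : (T′ : Subset n → Set) → IsCircuitSimplex k T′ → (∀ I → StableKSubset k (n / k) I → T′ I) →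
      ∀ I → T′ I → StableKSubset k (n / k) I
    maximal T′ simplex T⊆T′ I I∈T′ = from-mechanical (balanced⇒mechanical (comparable⇒balanced Pn≡k comparable) Pn≡k)
      where
      Pn≡k : count I n ≡ k
      Pn≡k = trans (sym (∣v∣≡count I)) (circuitSimplex-kSubset simplex I∈T′)

      comparable : ∀ {u} → u < n → Leads 0 (mechanical u) I ⊎ Leads 0 I (mechanical u)
      comparable u<n = circuitSimplex-comparable simplex (T⊆T′ _ (mechanical-stableKSubset u<n ≤-refl)) I∈T′

      from-mechanical : (∃ λ u → u < n × I ≡ mechanical u) → StableKSubset k (n / k) I
      from-mechanical (u , u<n , refl) = mechanical-stableKSubset u<n ≤-refl

  stable-dimension : ∀ {r} → r ≤ n / k → ConvDim (StableKSubset {n} k r) (q * k)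
  stable-dimension r≤n/k =
    (vertex , (λ a → vertex-stable a r≤n/k) , vertex-affIndep) ,
    λ m f f-stable affIndep → affIndep-kSubsets⇒≤ f (λ a → proj₁ (f-stable a)) affIndep

lemma2p6 : (n k : ℕ) → .{{_ : NonZero k}} → k < n → k ∣ n ∸ 1 →
    ((r : ℕ) → 1 ≤ r → r ≤ n / k → ConvDim (StableKSubset {n} k r) (n ∸ 1))
    × (Σ (Fin n → Subset n) λ f →
         (∀ a → StableKSubset k (n / k) (f a))
         × (∀ I → StableKSubset k (n / k) I → ∃ λ a → f a ≡ I)
         × Injective _≡_ _≡_ f
         × Unimodular f
         × IsMaxCircuitSimplex k (StableKSubset {n} k (n / k)))
lemma2p6 n zero _ _ = ⊥-elim (≢-nonZero⁻¹ 0 refl)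
lemma2p6 (suc _) (suc k′) (s≤s ()) (divides zero refl)
lemma2p6 (suc _) (suc k′) _ (divides (suc q′) refl) =
  (λ r _ r≤n/k → stable-dimension r≤n/k) ,
  vertex , (λ a → vertex-stable a ≤-refl) , stable⇒vertex , vertex-injective , vertex-unimodular , stable-maxCircuitSimplex
  where open Slope k′ q′
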